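{- Let $\lambda$ and $\mu$ be partitions of $m$. Let $\mathrm{STD}'(\lambda)$ be a maximal subset of the set $\mathrm{STD}(\lambda)$ of standard tableaux on $\lambda$ such that $\{Y_\mu\Delta_Q : Q\in\mathrm{STD}'(\lambda)\}$ is $\mathbb{C}$-linearly independent, and let $Q,Q'\in\mathrm{STD}'(\lambda)$. Then $\nu_\mu\circ Q$ is a semi-standard tableau on $\lambda$ with weight $\mu$, and if $Q\ne Q'$ then $\nu_\mu\circ Q\ne\nu_\mu\circ Q'$.
   Context: $S_m$ acts on $\mathbb{C}[x_1,\ldots,x_m]$ by $\sigma x_i=x_{\sigma(i)}$. A standard tableau $Q$ on $\lambda$ is a bijection from the boxes of $\lambda$ to $\{1,\ldots,m\}$ increasing along rows and down columns; its Specht polynomial is $\Delta_Q=\prod_{\text{columns }c}\prod_{i<i'}(x_{Q_{i,c}}-x_{Q_{i',c}})$. A semi-standard tableau on $\lambda$ with weight $w=(w_1,w_2,\ldots)$ is a map $T$ from the boxes of $\lambda$ to positive integers with $T_{i,j}<T_{i+1,j}$, $T_{i,j}\le T_{i,j+1}$ and $|T^{ -1}(\{k\})|=w_k$ for all $k$. $t_\mu$ is the numbering of the diagram of $\mu$ by $1,\ldots,m$ left to right along rows, top row first; $\nu_\mu(i)$ is the index of the row of $t_\mu$ containing $i$. $S_\mu=S_{\{1,\ldots,\mu_1\}}\times S_{\{\mu_1+1,\ldots,\mu_1+\mu_2\}}\times\cdots$, $Y_\mu=\frac1{|S_\mu|}\sum_{\sigma\in S_\mu}\sigma$. -}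

module Defs where

open import Level using (Level; _⊔_) renaming (suc to lsuc)
open import Algebra.Bundles using (CommutativeRing)
open import Data.Nat as ℕ using (ℕ; zero; suc; _≤_; _<_; _≥_; _∸_; _≤ᵇ_; _≡ᵇ_)
open import Data.Nat.Properties using (_≟_)
open import Data.Nat.ListAction using (sum)
open import Data.Fin using (Fin; toℕ)
open import Data.Fin.Properties using () renaming (_≟_ to _≟ᶠ_)
open import Data.Vec as Vec using (Vec; []; _∷_; tabulate; lookup)
open import Data.Vec.Properties using (≡-dec)
open import Data.List as List using (List; []; _∷_; map; concat; concatMap; length; upTo; allFin; filter; filterᵇ; foldr; mapMaybe; zipWith; _++_)
open import Data.List.Relation.Unary.All using (All)
open import Data.List.Relation.Unary.Linked using (Linked)
open import Data.List.Relation.Binary.Permutation.Propositional using (_↭_)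
open import Data.List.Membership.Propositional using (_∈_; _∉_)
open import Data.List.Relation.Unary.Unique.Propositional using (Unique)
open import Data.Maybe using (Maybe; just; nothing)
open import Data.Product using (Σ; _×_; _,_; proj₁)
open import Data.Bool using (Bool; true; false; if_then_else_; _∧_)
open import Relation.Binary.PropositionalEquality using (_≡_)
open import Relation.Nullary using (¬_; does)

-- Partitions and tableaux (entries/rows are numbered from 1 as in the
-- paper; a tableau is stored as its list of rows, top row first)

IsPartition : ℕ → List ℕ → Set
IsPartition m la = Linked _≥_ la × All (λ k → 1 ≤ k) la × sum la ≡ m

Tableau : Set
Tableau = List (List ℕ)

shape : Tableau → List ℕ
shape = map length

nth : List ℕ → ℕ → Maybe ℕ
nth []       _       = nothing
nth (x ∷ xs) zero    = just x
nth (x ∷ xs) (suc j) = nth xs j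

-- entry T i j : the entry in (0-based) row i, column j, if that box exists
entry : Tableau → ℕ → ℕ → Maybe ℕ
entry []      _       _ = nothing
entry (r ∷ T) zero    j = nth r j
entry (r ∷ T) (suc i) j = entry T i j

ColumnsRel : (ℕ → ℕ → Set) → Tableau → Set
ColumnsRel R T = ∀ i j a b → entry T i j ≡ just a → entry T (suc i) j ≡ just b → R a b

IsStandard : ℕ → List ℕ → Tableau → Set
IsStandard m la T =
  shape T ≡ la × All (Linked _<_) T × ColumnsRel _<_ T × concat T ↭ map suc (upTo m)

-- w_k (k ≥ 1) read off the list w, 0 beyond its length
weightAt : List ℕ → ℕ → ℕ
weightAt w k with nth w (k ∸ 1)
... | just a  = a
... | nothing = 0

count : ℕ → List ℕ → ℕ
count k xs = length (filter (k ≟_) xs)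

IsSemiStandard : List ℕ → List ℕ → Tableau → Set
IsSemiStandard la w T =
  shape T ≡ la × All (Linked _≤_) T × ColumnsRel _<_ T ×
  All (All (λ a → 1 ≤ a)) T × (∀ k → 1 ≤ k → count k (concat T) ≡ weightAt w k)

-- ν_μ(i): index (from 1) of the row of t_μ containing i
-- (row r of t_μ holds μ_1+…+μ_{r-1}+1, …, μ_1+…+μ_r)
nu : List ℕ → ℕ → ℕ
nu []      i = 0
nu (r ∷ μ) i = if i ≤ᵇ r then 1 else suc (nu μ (i ∸ r))

nuT : List ℕ → Tableau → Tableau
nuT μ Q = map (map (nu μ)) Q

natK : ∀ {c ℓ} (R : CommutativeRing c ℓ) → ℕ → CommutativeRing.Carrier R
natK R zero    = CommutativeRing.0# R
natK R (suc n) = CommutativeRing._+_ R (CommutativeRing.1# R) (natK R n)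

record CharZeroField c ℓ : Set (lsuc (c ⊔ ℓ)) where
  field
    commRing : CommutativeRing c ℓ
  open CommutativeRing commRing public
  field
    0≉1      : ¬ (0# ≈ 1#)
    inv      : (x : Carrier) → ¬ (x ≈ 0#) → Carrier
    inv-law  : ∀ x (p : ¬ (x ≈ 0#)) → (x * inv x p) ≈ 1#
    charZero : ∀ n → ¬ (natK commRing (suc n) ≈ 0#)

-- Polynomials in x_1,…,x_m over a field K: finite formal sums of
-- terms c·x^e (e : Vec ℕ m, e_i = exponent of x_{i+1}), compared by
-- coefficients.

module _ {c ℓ} (K : CharZeroField c ℓ) (m : ℕ) where
  open CharZeroField K

  Poly : Set c
  Poly = List (Carrier × Vec ℕ m)

  coeff : Poly → Vec ℕ m → Carrier
  coeff p e = foldr (λ t acc → if does (≡-dec _≟_ (Data.Product.proj₂ t) e)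
                                 then proj₁ t + acc else acc) 0# p

  _≈P_ : Poly → Poly → Set ℓ
  p ≈P q = ∀ e → coeff p e ≈ coeff q e

  0P : Poly
  0P = []

  1P : Poly
  1P = (1# , Vec.replicate m 0) ∷ []

  _+P_ : Poly → Poly → Poly
  p +P q = p ++ q

  _·P_ : Carrier → Poly → Poly
  a ·P p = map (λ t → (a * proj₁ t) , Data.Product.proj₂ t) p

  _*P_ : Poly → Poly → Poly
  p *P q = concatMap (λ s → map (λ t → (proj₁ s * proj₁ t) ,
             Vec.zipWith ℕ._+_ (Data.Product.proj₂ s) (Data.Product.proj₂ t)) q) p

  _-P_ : Poly → Poly → Poly
  p -P q = p +P ((- 1#) ·P q)

  sumP : List Poly → Poly
  sumP = foldr _+P_ 0P

  prodP : List Poly → Poly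
  prodP = foldr _*P_ 1P

  var : ℕ → Poly
  var k = (1# , tabulate (λ i → if (suc (toℕ i) ≡ᵇ k) then 1 else 0)) ∷ []

  -- σ acts by the substitution x_i ↦ x_{σ(i)} (σ : Fin m → Fin m given as
  -- a vector; index i stands for the number i+1)
  pushExp : Vec (Fin m) m → Vec ℕ m → Vec ℕ m
  pushExp σ e = tabulate (λ j → sum (map (λ i → if does (lookup σ i ≟ᶠ j)
                                                  then lookup e i else 0) (allFin m)))

  act : Vec (Fin m) m → Poly → Poly
  act σ p = map (λ t → proj₁ t , pushExp σ (Data.Product.proj₂ t)) p

  allVecs : (k : ℕ) → List (Vec (Fin m) k)
  allVecs zero    = [] ∷ []
  allVecs (suc k) = concatMap (λ v → map (λ a → a ∷ v) (allFin m)) (allVecs k)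

  allᵇ : {A : Set} → (A → Bool) → List A → Bool
  allᵇ p = foldr (λ a b → p a ∧ b) true

  isPermᵇ : Vec (Fin m) m → Bool
  isPermᵇ σ = allᵇ (λ i → allᵇ (λ j → if does (lookup σ i ≟ᶠ lookup σ j)
                                        then does (i ≟ᶠ j) else true) (allFin m)) (allFin m)

  inSμᵇ : List ℕ → Vec (Fin m) m → Bool
  inSμᵇ μ σ = isPermᵇ σ ∧
    allᵇ (λ i → nu μ (suc (toℕ (lookup σ i))) ≡ᵇ nu μ (suc (toℕ i))) (allFin m)

  Sμ : List ℕ → List (Vec (Fin m) m)
  Sμ μ = filterᵇ (inSμᵇ μ) (allVecs m)

  -- 1/n in K (n ≥ 1; the value at 0 is never used since id ∈ S_μ)
  recipNat : ℕ → Carrier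
  recipNat zero    = 0#
  recipNat (suc n) = inv (natK commRing (suc n)) (charZero n)

  Yμ : List ℕ → Poly → Poly
  Yμ μ p = recipNat (length (Sμ μ)) ·P sumP (map (λ σ → act σ p) (Sμ μ))

  -- columns of a tableau (top to bottom), indexed by the first row
  columns : Tableau → List (List ℕ)
  columns []      = []
  columns (r ∷ T) = map (λ j → mapMaybe (λ row → nth row j) (r ∷ T)) (upTo (length r))

  pairs : List ℕ → List (ℕ × ℕ)
  pairs []       = []
  pairs (a ∷ as) = map (λ b → a , b) as ++ pairs as

  specht : Tableau → Poly
  specht Q = prodP (concatMap (λ col → map (λ ab → var (proj₁ ab) -P var (Data.Product.proj₂ ab))
                                              (pairs col)) (columns Q))

  LinIndep : List Poly → Set (c ⊔ ℓ)
  LinIndep vs = ∀ (cs : List Carrier) → length cs ≡ length vs →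
                sumP (zipWith _·P_ cs vs) ≈P 0P → All (λ a → a ≈ 0#) cs

  IsMaxIndepStd : List ℕ → List ℕ → List Tableau → Set (c ⊔ ℓ)
  IsMaxIndepStd la μ S =
    All (IsStandard m la) S × Unique S ×
    LinIndep (map (λ Q → Yμ μ (specht Q)) S) ×
    (∀ Q → IsStandard m la Q → Q ∉ S → ¬ LinIndep (map (λ Q → Yμ μ (specht Q)) (Q ∷ S)))

-- Write Y for Y_μ and Δ_T for the Specht polynomial of a tableau T with entries 1, …, m.
-- Every σ ∈ S_μ satisfies Y (σ p) = Y p, so relabelling T by a transposition (a b) of two
-- numbers in the same row of t_μ does not change Y Δ_T. If moreover a and b are adjacent
-- entries of one column of T, the relabelling negates Δ_T, whence Y Δ_T = − Y Δ_T = 0 since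
-- char K = 0. A member of a linearly independent family is nonzero, so ν_μ ∘ Q increases
-- strictly down the columns; it increases weakly along the rows and has weight μ for every
-- standard Q. Finally, if ν_μ ∘ Q = ν_μ ∘ Q′, then Q is sorted into Q′ by transpositions of
-- entries in equal rows of t_μ, so Y Δ_Q = Y Δ_Q′, which two distinct members of an
-- independent family cannot satisfy.

module Submission where

open import Defs
open import Data.Nat using (ℕ)
open import Data.List using (List)
open import Data.List.Membership.Propositional using (_∈_)
open import Data.Product using (_×_)
open import Relation.Nullary using (¬_)
open import Relation.Binary.PropositionalEquality using (_≡_)

open import Level using (Level)
open import Algebra.Bundles using (CommutativeSemiring)
open import Algebra.Structures using (IsCommutativeMonoid)
open import Data.Bool using (Bool; true; false; if_then_else_; T)
open import Data.Bool.Properties using (T-∧)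
open import Data.Empty using (⊥-elim)
open import Data.Fin as Fin using (Fin; toℕ)
import Data.Fin.Properties as Finₚ
open import Data.Nat as ℕ using (zero; suc; _∸_; _≤_; _<_; _≥_; _≤ᵇ_; _≡ᵇ_; z≤n; s≤s; _≤?_)
import Data.Nat.Properties as ℕₚ
open import Data.Nat.ListAction using (sum)
open import Data.List as List using ([]; _∷_; _++_; [_]; map; concat; concatMap; length; replicate; applyUpTo; upTo; allFin; mapMaybe)
import Data.List.Properties as Listₚ
open import Data.List.Membership.Propositional using (_∉_)
open import Data.List.Membership.Propositional.Properties
  using (∈-++⁺ˡ; ∈-++⁺ʳ; ∈-map⁺; ∈-map⁻; ∈-upTo⁺; ∈-upTo⁻; ∈-allFin; ∈-cartesianProductWith⁺; ∈-filter⁺; ∈-filter⁻)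
open import Data.List.Membership.Propositional.Properties.WithK using (unique∧set⇒bag)
open import Data.List.Relation.Binary.BagAndSetEquality using (∼bag⇒↭)
open import Data.List.Relation.Binary.Permutation.Propositional using (_↭_; ↭-refl; ↭-sym; ↭-swap; ↭⇒↭ₛ; ↭⇒↭ₛ′)
import Data.List.Relation.Binary.Permutation.Propositional.Properties as Permₚ
import Data.List.Relation.Binary.Permutation.Setoid.Properties as Permₛ
open import Data.List.Relation.Unary.Any using (here; there)
open import Data.List.Relation.Unary.All as All using (All; []; _∷_)
import Data.List.Relation.Unary.All.Properties as All
open import Data.List.Relation.Unary.AllPairs as AllPairs using ([]; _∷_)
open import Data.List.Relation.Unary.Linked as Linked using (Linked; _∷_)
import Data.List.Relation.Unary.Linked.Properties as Linked
open import Data.List.Relation.Unary.Unique.Propositional using (Unique)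
import Data.List.Relation.Unary.Unique.Propositional.Properties as Unique
open import Data.Maybe as Maybe using (just; nothing)
import Data.Maybe.Properties as Maybeₚ
open import Data.Product as Product using (∃; ∃₂; _,_; proj₁; proj₂)
open import Data.Vec as Vec using (Vec; lookup; tabulate; zipWith)
import Data.Vec.Properties as Vecₚ
open import Function using (_∘_; id)
open import Function.Bundles using (Equivalence; mk⇔)
open import Relation.Binary.Bundles using (Setoid)
open import Relation.Binary.Definitions using (DecidableEquality)
open import Relation.Binary.PropositionalEquality as ≡ using (_≢_; refl; sym; trans; cong; cong₂; subst; module ≡-Reasoning)
import Relation.Binary.Reasoning.Setoid
open import Relation.Nullary using (Dec; does; yes; no; contradiction)
open import Relation.Nullary.Decidable using (dec-true; dec-false; T?)
open import Algebra.Properties.CommutativeMonoid.Sum ℕₚ.+-0-commutativeMonoid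
  using (∑-distrib-+; ∑-comm; sum-cong-≗) renaming (sum to ∑)

-- Rows of t_μ

nu-head : ∀ r μ {i} → i ≤ r → nu (r ∷ μ) i ≡ 1
nu-head r μ {i} i≤r with i ≤ᵇ r | ℕₚ.≤⇒≤ᵇ i≤r
... | true | _ = refl

nu-tail : ∀ r μ {i} → r < i → nu (r ∷ μ) i ≡ suc (nu μ (i ∸ r))
nu-tail r μ {i} r<i with i ≤ᵇ r in eq
... | true  = contradiction (ℕₚ.≤ᵇ⇒≤ i r (subst T (sym eq) _)) (ℕₚ.<⇒≱ r<i)
... | false = refl

nu-positive : ∀ r μ i → 1 ≤ nu (r ∷ μ) i
nu-positive r μ i with i ≤ᵇ r
... | true  = s≤s z≤n
... | false = s≤s z≤n

nu-mono : ∀ μ {i j} → i ≤ j → nu μ i ≤ nu μ j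
nu-mono []      _ = z≤n
nu-mono (r ∷ μ) {i} {j} i≤j with j ≤? r | i ≤? r
... | yes j≤r | _ rewrite nu-head r μ (ℕₚ.≤-trans i≤j j≤r) | nu-head r μ j≤r = ℕₚ.≤-refl
... | no j≰r | yes i≤r rewrite nu-head r μ i≤r | nu-tail r μ (ℕₚ.≰⇒> j≰r) = s≤s z≤n
... | no j≰r | no i≰r rewrite nu-tail r μ (ℕₚ.≰⇒> i≰r) | nu-tail r μ (ℕₚ.≰⇒> j≰r) =
  s≤s (nu-mono μ (ℕₚ.∸-monoˡ-≤ r i≤j))

rowWord : List ℕ → List ℕ
rowWord []      = []
rowWord (r ∷ μ) = replicate r 1 ++ map suc (rowWord μ)

applyUpTo-++ : ∀ {A : Set} (f : ℕ → A) r s → applyUpTo f (r ℕ.+ s) ≡ applyUpTo f r ++ applyUpTo (f ∘ (r ℕ.+_)) s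
applyUpTo-++ f zero    s = refl
applyUpTo-++ f (suc r) s = cong (f 0 ∷_) (applyUpTo-++ (f ∘ suc) r s)

applyUpTo-cong-< : ∀ {A : Set} {f g : ℕ → A} n → (∀ {x} → x < n → f x ≡ g x) → applyUpTo f n ≡ applyUpTo g n
applyUpTo-cong-< zero    eq = refl
applyUpTo-cong-< (suc n) eq = cong₂ _∷_ (eq (s≤s z≤n)) (applyUpTo-cong-< n (eq ∘ s≤s))

applyUpTo-const : ∀ {A : Set} (a : A) n → applyUpTo (λ _ → a) n ≡ replicate n a
applyUpTo-const a zero    = refl
applyUpTo-const a (suc n) = cong (a ∷_) (applyUpTo-const a n)

nu-rowWord : ∀ μ → applyUpTo (nu μ ∘ suc) (sum μ) ≡ rowWord μ
nu-rowWord []      = refl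
nu-rowWord (r ∷ μ) = begin
  applyUpTo (nu (r ∷ μ) ∘ suc) (r ℕ.+ sum μ)
    ≡⟨ applyUpTo-++ (nu (r ∷ μ) ∘ suc) r (sum μ) ⟩
  applyUpTo (nu (r ∷ μ) ∘ suc) r ++ applyUpTo (nu (r ∷ μ) ∘ suc ∘ (r ℕ.+_)) (sum μ)
    ≡⟨ cong₂ _++_ (trans (applyUpTo-cong-< r (nu-head r μ)) (applyUpTo-const 1 r))
                  (trans (applyUpTo-cong-< (sum μ) (λ {x} _ → tail x)) (sym (Listₚ.map-applyUpTo (nu μ ∘ suc) suc (sum μ)))) ⟩
  replicate r 1 ++ map suc (applyUpTo (nu μ ∘ suc) (sum μ))
    ≡⟨ cong (λ w → replicate r 1 ++ map suc w) (nu-rowWord μ) ⟩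
  rowWord (r ∷ μ) ∎
  where
  open ≡-Reasoning
  tail : ∀ x → nu (r ∷ μ) (suc (r ℕ.+ x)) ≡ suc (nu μ (suc x))
  tail x rewrite nu-tail r μ (s≤s (ℕₚ.m≤m+n r x)) | sym (ℕₚ.+-suc r x) | ℕₚ.m+n∸m≡n r (suc x) = refl

count-++ : ∀ k xs ys → count k (xs ++ ys) ≡ count k xs ℕ.+ count k ys
count-++ k xs ys = trans (cong length (Listₚ.filter-++ (k ℕₚ.≟_) xs ys)) (Listₚ.length-++ (List.filter (k ℕₚ.≟_) xs))

count-map-suc : ∀ k xs → count (suc k) (map suc xs) ≡ count k xs
count-map-suc k []       = refl
count-map-suc k (x ∷ xs) with k ℕ.≡ᵇ x
... | true  = cong suc (count-map-suc k xs)
... | false = count-map-suc k xs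

count-zero-map-suc : ∀ xs → count 0 (map suc xs) ≡ 0
count-zero-map-suc []       = refl
count-zero-map-suc (x ∷ xs) = count-zero-map-suc xs

count-replicate-≡ : ∀ x r → count x (replicate r x) ≡ r
count-replicate-≡ x zero    = refl
count-replicate-≡ x (suc r) = trans (cong length (Listₚ.filter-accept (x ℕₚ.≟_) refl)) (cong suc (count-replicate-≡ x r))

count-replicate-≢ : ∀ {k x} r → k ≢ x → count k (replicate r x) ≡ 0
count-replicate-≢ zero    _   = refl
count-replicate-≢ (suc r) k≢x = trans (cong length (Listₚ.filter-reject (_ ℕₚ.≟_) k≢x)) (count-replicate-≢ r k≢x)

count-zero-rowWord : ∀ μ → count 0 (rowWord μ) ≡ 0
count-zero-rowWord []      = refl
count-zero-rowWord (r ∷ μ) = trans (count-++ 0 (replicate r 1) (map suc (rowWord μ)))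
  (cong₂ ℕ._+_ (count-replicate-≢ r (λ ())) (count-zero-map-suc (rowWord μ)))

weightAt-cons : ∀ r μ k → weightAt (r ∷ μ) (suc (suc k)) ≡ weightAt μ (suc k)
weightAt-cons r μ k with nth μ k
... | just _  = refl
... | nothing = refl

count-rowWord : ∀ μ k → 1 ≤ k → count k (rowWord μ) ≡ weightAt μ k
count-rowWord []      k _ = refl
count-rowWord (r ∷ μ) (suc k) _ = trans (count-++ (suc k) (replicate r 1) (map suc (rowWord μ)))
  (trans (cong (count (suc k) (replicate r 1) ℕ.+_) (count-map-suc k (rowWord μ))) (go k))
  where
  go : ∀ k → count (suc k) (replicate r 1) ℕ.+ count k (rowWord μ) ≡ weightAt (r ∷ μ) (suc k)
  go zero    = trans (cong₂ ℕ._+_ (count-replicate-≡ 1 r) (count-zero-rowWord μ)) (ℕₚ.+-identityʳ r)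
  go (suc k) = trans (cong (ℕ._+ count (suc k) (rowWord μ)) (count-replicate-≢ r λ ()))
                     (trans (count-rowWord μ (suc k) (s≤s z≤n)) (sym (weightAt-cons r μ k)))

-- Entries and columns of tableaux

module _ {A : Set} where

  Unique-++⁻ʳ : ∀ (u : List A) {w} → Unique (u ++ w) → Unique w
  Unique-++⁻ʳ []      uw       = uw
  Unique-++⁻ʳ (x ∷ u) (_ ∷ uw) = Unique-++⁻ʳ u uw

  Unique-++⁻ˡ : ∀ (u : List A) {w} → Unique (u ++ w) → Unique u
  Unique-++⁻ˡ []      _         = AllPairs.[]
  Unique-++⁻ˡ (x ∷ u) (x∉ ∷ uw) = All.++⁻ˡ u x∉ ∷ Unique-++⁻ˡ u uw

  Unique-++-∉ : ∀ (u : List A) {w x} → Unique (u ++ w) → x ∈ w → x ∉ u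
  Unique-++-∉ (y ∷ u) (y∉ ∷ _)  x∈w (here refl) = All.lookup y∉ (∈-++⁺ʳ u x∈w) refl
  Unique-++-∉ (y ∷ u) (_ ∷ uw) x∈w (there x∈u) = Unique-++-∉ u uw x∈w x∈u

nth-∈ : ∀ r j {x} → nth r j ≡ just x → x ∈ r
nth-∈ (y ∷ r) zero    refl = here refl
nth-∈ (y ∷ r) (suc j) eq   = there (nth-∈ r j eq)

nth-< : ∀ r j {x} → nth r j ≡ just x → j < length r
nth-< (y ∷ r) zero    _  = s≤s z≤n
nth-< (y ∷ r) (suc j) eq = s≤s (nth-< r j eq)

nth-injective : ∀ r {j j′ x} → Unique r → nth r j ≡ just x → nth r j′ ≡ just x → j ≡ j′
nth-injective (y ∷ r) {zero}  {zero}    _        _    _    = refl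
nth-injective (y ∷ r) {zero}  {suc j′}  (y∉ ∷ _) refl eq′  = ⊥-elim (All.lookup y∉ (nth-∈ r j′ eq′) refl)
nth-injective (y ∷ r) {suc j} {zero}    (y∉ ∷ _) eq   refl = ⊥-elim (All.lookup y∉ (nth-∈ r j eq) refl)
nth-injective (y ∷ r) {suc j} {suc j′}  (_ ∷ ur) eq   eq′  = cong suc (nth-injective r ur eq eq′)

nth-map : ∀ (f : ℕ → ℕ) r j → nth (map f r) j ≡ Maybe.map f (nth r j)
nth-map f []      j       = refl
nth-map f (x ∷ r) zero    = refl
nth-map f (x ∷ r) (suc j) = nth-map f r j

entry-∈ : ∀ T i j {x} → entry T i j ≡ just x → x ∈ concat T
entry-∈ (r ∷ T) zero    j eq = ∈-++⁺ˡ (nth-∈ r j eq)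
entry-∈ (r ∷ T) (suc i) j eq = ∈-++⁺ʳ r (entry-∈ T i j eq)

entry-map : ∀ (f : ℕ → ℕ) T i j → entry (map (map f) T) i j ≡ Maybe.map f (entry T i j)
entry-map f []      i       j = refl
entry-map f (r ∷ T) zero    j = nth-map f r j
entry-map f (r ∷ T) (suc i) j = entry-map f T i j

entry-map-just : ∀ (f : ℕ → ℕ) T i j {y} → entry (map (map f) T) i j ≡ just y →
                 ∃ λ x → entry T i j ≡ just x × y ≡ f x
entry-map-just f T i j eq with entry T i j | entry-map f T i j
... | just x  | eq′ = x , refl , Maybeₚ.just-injective (trans (sym eq) eq′)
... | nothing | eq′ with () ← trans (sym eq) eq′

entry-<-length : ∀ r T i j {x} → Linked _≥_ (shape (r ∷ T)) → entry (r ∷ T) i j ≡ just x → j < length r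
entry-<-length r T       zero    j _          eq = nth-< r j eq
entry-<-length r (r′ ∷ T) (suc i) j (r≥r′ ∷ l) eq = ℕₚ.<-≤-trans (entry-<-length r′ T i j l eq) r≥r′

entry-column-injective : ∀ T {i i′ j j′ x} → Unique (concat T) →
                         entry T i j ≡ just x → entry T i′ j′ ≡ just x → j ≡ j′
entry-column-injective (r ∷ T) {zero}  {zero}            u eq eq′ = nth-injective r (Unique-++⁻ˡ r u) eq eq′
entry-column-injective (r ∷ T) {zero}  {suc i′} {j} {j′} u eq eq′ = ⊥-elim (Unique-++-∉ r u (entry-∈ T i′ j′ eq′) (nth-∈ r j eq))
entry-column-injective (r ∷ T) {suc i} {zero}   {j} {j′} u eq eq′ = ⊥-elim (Unique-++-∉ r u (entry-∈ T i j eq) (nth-∈ r j′ eq′))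
entry-column-injective (r ∷ T) {suc i} {suc i′}          u eq eq′ = entry-column-injective T (Unique-++⁻ʳ r u) eq eq′

column : Tableau → ℕ → List ℕ
column T j = mapMaybe (λ row → nth row j) T

∈-column⁻ : ∀ T j {x} → x ∈ column T j → ∃ λ i → entry T i j ≡ just x
∈-column⁻ (r ∷ T) j x∈ with nth r j in eq
∈-column⁻ (r ∷ T) j (here refl) | just y = zero , eq
∈-column⁻ (r ∷ T) j (there x∈) | just y with i , e ← ∈-column⁻ T j x∈ = suc i , e
∈-column⁻ (r ∷ T) j x∈          | nothing with i , e ← ∈-column⁻ T j x∈ = suc i , e

column-split : ∀ T i j {a b} → entry T i j ≡ just a → entry T (suc i) j ≡ just b →
               ∃₂ λ u v → column T j ≡ u ++ a ∷ b ∷ v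
column-split (r ∷ r′ ∷ T) zero j ea eb rewrite ea | eb = [] , column T j , refl
column-split (r ∷ T) (suc i) j ea eb with column-split T i j ea eb | nth r j
... | u , v , eq | just x  = x ∷ u , v , cong (x ∷_) eq
... | u , v , eq | nothing = u , v , eq

column-unique : ∀ T j → Unique (concat T) → Unique (column T j)
column-unique []      j _ = AllPairs.[]
column-unique (r ∷ T) j u with nth r j in eq
... | just x  = All.tabulate (λ y∈ x≡y → Unique-++-∉ r u (subst (_∈ concat T) (sym x≡y) (entry-∈ T _ j (proj₂ (∈-column⁻ T j y∈))))
                                                   (nth-∈ r j eq))
              ∷ column-unique T j (Unique-++⁻ʳ r u)
... | nothing = column-unique T j (Unique-++⁻ʳ r u)

column-map : ∀ (f : ℕ → ℕ) T j → column (map (map f) T) j ≡ map f (column T j)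
column-map f []      j = refl
column-map f (r ∷ T) j rewrite nth-map f r j with nth r j
... | just x  = cong (f x ∷_) (column-map f T j)
... | nothing = column-map f T j

++-injective : ∀ {A : Set} (u u′ : List A) {w w′} → length u ≡ length u′ → u ++ w ≡ u′ ++ w′ → u ≡ u′ × w ≡ w′
++-injective []      []       _   eq = refl , eq
++-injective (x ∷ u) (x′ ∷ u′) len eq
  with refl , eq′ ← Listₚ.∷-injective eq
  with refl , w≡ ← ++-injective u u′ (ℕₚ.suc-injective len) eq′ = refl , w≡

concat-injective : ∀ T T′ → shape T ≡ shape T′ → concat T ≡ concat T′ → T ≡ T′
concat-injective []      []        _  _  = refl
concat-injective (r ∷ T) (r′ ∷ T′) sh eq with len , sh′ ← Listₚ.∷-injective sh with refl , eq′ ← ++-injective r r′ len eq =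
  cong (r ∷_) (concat-injective T T′ sh′ eq′)

-- Transpositions

module Transposition {a} {A : Set a} (_≟_ : DecidableEquality A) where

  transpose : A → A → A → A
  transpose a b x with x ≟ a | x ≟ b
  ... | yes _ | _     = b
  ... | no _  | yes _ = a
  ... | no _  | no _  = x

  transpose-first : ∀ a b → transpose a b a ≡ b
  transpose-first a b with a ≟ a | a ≟ b
  ... | yes _  | _ = refl
  ... | no a≢a | _ = ⊥-elim (a≢a refl)

  transpose-second : ∀ a b → transpose a b b ≡ a
  transpose-second a b with b ≟ a | b ≟ b
  ... | yes refl | _      = refl
  ... | no _     | yes _  = refl
  ... | no _     | no b≢b = ⊥-elim (b≢b refl)

  transpose-fixed : ∀ a b {x} → x ≢ a → x ≢ b → transpose a b x ≡ x
  transpose-fixed a b {x} x≢a x≢b with x ≟ a | x ≟ b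
  ... | yes x≡a | _       = ⊥-elim (x≢a x≡a)
  ... | no _    | yes x≡b = ⊥-elim (x≢b x≡b)
  ... | no _    | no _    = refl

  transpose-involutive : ∀ a b x → transpose a b (transpose a b x) ≡ x
  transpose-involutive a b x with x ≟ a | x ≟ b
  ... | yes refl | _        = transpose-second x b
  ... | no _     | yes refl = transpose-first a x
  ... | no x≢a   | no x≢b   = transpose-fixed a b x≢a x≢b

  transpose-injective : ∀ a b {x y} → transpose a b x ≡ transpose a b y → x ≡ y
  transpose-injective a b {x} {y} eq =
    trans (sym (transpose-involutive a b x)) (trans (cong (transpose a b) eq) (transpose-involutive a b y))

  transpose-cases : ∀ {p} (P : A → Set p) a b x → P a → P b → P x → P (transpose a b x)
  transpose-cases P a b x Pa Pb Px with x ≟ a | x ≟ b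
  ... | yes _ | _     = Pb
  ... | no _  | yes _ = Pa
  ... | no _  | no _  = Px

  transpose-respects : ∀ {b} {B : Set b} (f : A → B) a b → f a ≡ f b → ∀ x → f (transpose a b x) ≡ f x
  transpose-respects f a b fa≡fb x with x ≟ a | x ≟ b
  ... | yes refl | _        = sym fa≡fb
  ... | no _     | yes refl = fa≡fb
  ... | no _     | no _     = refl

open Transposition ℕₚ._≟_ public

module _ {a b} {A : Set a} {B : Set b} (_≟ᴬ_ : DecidableEquality A) (_≟ᴮ_ : DecidableEquality B) where
  private
    module TA = Transposition _≟ᴬ_
    module TB = Transposition _≟ᴮ_

  transpose-map : ∀ (f : A → B) → (∀ {x y} → f x ≡ f y → x ≡ y) → ∀ a b x → f (TA.transpose a b x) ≡ TB.transpose (f a) (f b) (f x)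
  transpose-map f inj a b x with x ≟ᴬ a | x ≟ᴬ b
  ... | yes refl | _        = sym (TB.transpose-first (f x) (f b))
  ... | no _     | yes refl = sym (TB.transpose-second (f a) (f x))
  ... | no x≢a   | no x≢b   = sym (TB.transpose-fixed (f a) (f b) (x≢a ∘ inj) (x≢b ∘ inj))

relabel : (ℕ → ℕ) → Tableau → Tableau
relabel f = map (map f)

transpose-fixes : ∀ a b {u} → a ∉ u → b ∉ u → map (transpose a b) u ≡ u
transpose-fixes a b a∉u b∉u =
  Listₚ.map-id-local (All.tabulate λ x∈u → transpose-fixed a b (λ { refl → a∉u x∈u }) (λ { refl → b∉u x∈u }))

module SortByTranspositions {r p}
  (ν : ℕ → ℕ) (R : ℕ → Set r) (P : Tableau → Set p)
  (P-transpose : ∀ T {a b} → R a → R b → ν a ≡ ν b → P (relabel (transpose a b) T) → P T)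
  (Q : Tableau) (PQ : P Q) (uQ : Unique (concat Q)) (RQ : All R (concat Q)) where

  private
    go : ∀ q p t T → concat T ≡ p ++ t → concat Q ≡ p ++ q → shape T ≡ shape Q →
         Unique (concat T) → All R (concat T) → map ν t ≡ map ν q → P T
    go [] p [] T cT cQ sh _ _ _ = subst P (sym (concat-injective T Q sh (trans cT (sym cQ)))) PQ
    go (y ∷ q) p (x ∷ t) T cT cQ sh uT RT νt with νx≡νy , νt′ ← Listₚ.∷-injective νt =
      P-transpose T Rx Ry νx≡νy
        (go q (p ++ [ y ]) (map s t) (relabel s T) cT′ (trans cQ (sym (Listₚ.++-assoc p [ y ] q))) sh′ uT′ RT′ νt″)
      where
      s = transpose x y
      x∈T : x ∈ concat T
      x∈T = subst (x ∈_) (sym cT) (∈-++⁺ʳ p (here refl))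
      y∈Q : y ∈ concat Q
      y∈Q = subst (y ∈_) (sym cQ) (∈-++⁺ʳ p (here refl))
      Rx = All.lookup RT x∈T
      Ry = All.lookup RQ y∈Q
      x∉p : x ∉ p
      x∉p = Unique-++-∉ p (subst Unique cT uT) (here refl)
      y∉p : y ∉ p
      y∉p = Unique-++-∉ p (subst Unique cQ uQ) (here refl)
      p-fixed : map s p ≡ p
      p-fixed = transpose-fixes x y x∉p y∉p
      cs : concat (relabel s T) ≡ map s (concat T)
      cs = Listₚ.concat-map T
      cT′ : concat (relabel s T) ≡ (p ++ [ y ]) ++ map s t
      cT′ = begin
        concat (relabel s T) ≡⟨ cs ⟩
        map s (concat T)     ≡⟨ cong (map s) cT ⟩
        map s (p ++ x ∷ t)   ≡⟨ Listₚ.map-++ s p (x ∷ t) ⟩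
        map s p ++ s x ∷ map s t ≡⟨ cong₂ (λ u z → u ++ z ∷ map s t) p-fixed (transpose-first x y) ⟩
        p ++ y ∷ map s t        ≡⟨ Listₚ.++-assoc p [ y ] (map s t) ⟨
        (p ++ [ y ]) ++ map s t ∎
        where open ≡-Reasoning
      sh′ : shape (relabel s T) ≡ shape Q
      sh′ = trans (sym (Listₚ.map-∘ T)) (trans (Listₚ.map-cong (Listₚ.length-map s) T) sh)
      uT′ : Unique (concat (relabel s T))
      uT′ = subst Unique (sym cs) (Unique.map⁺ (transpose-injective x y) uT)
      RT′ : All R (concat (relabel s T))
      RT′ = subst (All R) (sym cs) (All.map⁺ (All.map (transpose-cases R x y _ Rx Ry) RT))
      νt″ : map ν (map s t) ≡ map ν q
      νt″ = trans (sym (Listₚ.map-∘ t))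
              (trans (Listₚ.map-cong (transpose-respects ν x y νx≡νy) t) νt′)

  sort : ∀ T → shape T ≡ shape Q → Unique (concat T) → All R (concat T) → map ν (concat T) ≡ map ν (concat Q) → P T
  sort T sh uT RT νT = go (concat Q) [] (concat T) T refl refl sh uT RT νT

module _ (T : Tableau) (uT : Unique (concat T)) {i j a b} (ea : entry T i j ≡ just a) (eb : entry T (suc i) j ≡ just b) where

  transpose-column-other : ∀ j′ → j′ ≢ j → map (transpose a b) (column T j′) ≡ column T j′
  transpose-column-other j′ j′≢j = transpose-fixes a b (λ a∈ → not-in-column ea a∈) (λ b∈ → not-in-column eb b∈)
    where
    not-in-column : ∀ {i x} → entry T i j ≡ just x → x ∉ column T j′
    not-in-column ex x∈ with i′ , ex′ ← ∈-column⁻ T j′ x∈ = j′≢j (entry-column-injective T uT ex′ ex)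

  transpose-column : ∃₂ λ u v → column T j ≡ u ++ a ∷ b ∷ v × map (transpose a b) (column T j) ≡ u ++ b ∷ a ∷ v
  transpose-column with u , v , split ← column-split T i j ea eb = u , v , split , (begin
    map (transpose a b) (column T j)     ≡⟨ cong (map (transpose a b)) split ⟩
    map (transpose a b) (u ++ a ∷ b ∷ v) ≡⟨ Listₚ.map-++ (transpose a b) u (a ∷ b ∷ v) ⟩
    map (transpose a b) u ++ map (transpose a b) (a ∷ b ∷ v)
      ≡⟨ cong₂ _++_ (transpose-fixes a b a∉u b∉u)
                    (cong₂ _∷_ (transpose-first a b) (cong₂ _∷_ (transpose-second a b) (transpose-fixes a b a∉v b∉v))) ⟩
    u ++ b ∷ a ∷ v                                   ∎)
    where
    open ≡-Reasoning
    uc : Unique (u ++ a ∷ b ∷ v)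
    uc = subst Unique split (column-unique T j uT)
    a∉u = Unique-++-∉ u uc (here refl)
    b∉u = Unique-++-∉ u uc (there (here refl))
    uabv : Unique (a ∷ b ∷ v)
    uabv = Unique-++⁻ʳ u uc
    a∉v : a ∉ v
    a∉v a∈v with a∉bv AllPairs.∷ _ ← uabv = All.lookup a∉bv (there a∈v) refl
    b∉v : b ∉ v
    b∉v b∈v with _ AllPairs.∷ (b∉v AllPairs.∷ _) ← uabv = All.lookup b∉v b∈v refl

-- ν_μ ∘ Q for a standard tableau Q

InRange : ℕ → ℕ → Set
InRange m x = ∃ λ (k : Fin m) → suc (toℕ k) ≡ x

count-↭ : ∀ k {xs ys} → xs ↭ ys → count k xs ≡ count k ys
count-↭ k xs↭ys = Permₚ.↭-length (Permₚ.filter-↭ (k ℕₚ.≟_) xs↭ys)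

nu-positive-inRange : ∀ μ {x} → InRange (sum μ) x → 1 ≤ nu μ x
nu-positive-inRange (r ∷ μ) {x} _ = nu-positive r μ x

standard-unique : ∀ {m la Q} → IsStandard m la Q → Unique (concat Q)
standard-unique {m} (_ , _ , _ , Q↭) =
  Permₛ.Unique-resp-↭ (≡.setoid ℕ) (↭⇒↭ₛ (↭-sym Q↭)) (Unique.map⁺ ℕₚ.suc-injective (Unique.upTo⁺ m))

standard-inRange : ∀ {m la Q} → IsStandard m la Q → All (InRange m) (concat Q)
standard-inRange (_ , _ , _ , Q↭) = Permₚ.All-resp-↭ (↭-sym Q↭)
  (All.map⁺ (All.tabulate λ k∈ → Fin.fromℕ< (∈-upTo⁻ k∈) , cong suc (Finₚ.toℕ-fromℕ< (∈-upTo⁻ k∈))))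

nuT-shape : ∀ μ Q → shape (nuT μ Q) ≡ shape Q
nuT-shape μ Q = trans (sym (Listₚ.map-∘ Q)) (Listₚ.map-cong (Listₚ.length-map (nu μ)) Q)

nuT-rows : ∀ μ {Q} → All (Linked _<_) Q → All (Linked _≤_) (nuT μ Q)
nuT-rows μ rows = All.map⁺ (All.map (Linked.map⁺ ∘ Linked.map (nu-mono μ ∘ ℕₚ.<⇒≤)) rows)

nuT-positive : ∀ μ {Q} → All (InRange (sum μ)) (concat Q) → All (All (1 ≤_)) (nuT μ Q)
nuT-positive μ {Q} inRange = All.concat⁻ (subst (All (1 ≤_)) (sym (Listₚ.concat-map Q)) (All.map⁺ (All.map (nu-positive-inRange μ) inRange)))

nuT-weight : ∀ μ {Q} → concat Q ↭ map suc (upTo (sum μ)) → ∀ k → 1 ≤ k → count k (concat (nuT μ Q)) ≡ weightAt μ k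
nuT-weight μ {Q} Q↭ k 1≤k = begin
  count k (concat (nuT μ Q))                    ≡⟨ cong (count k) (Listₚ.concat-map Q) ⟩
  count k (map (nu μ) (concat Q))               ≡⟨ count-↭ k (Permₚ.map⁺ (nu μ) Q↭) ⟩
  count k (map (nu μ) (map suc (upTo (sum μ)))) ≡⟨ cong (count k) (trans (sym (Listₚ.map-∘ (upTo (sum μ)))) (Listₚ.map-upTo (nu μ ∘ suc) (sum μ))) ⟩
  count k (applyUpTo (nu μ ∘ suc) (sum μ))      ≡⟨ cong (count k) (nu-rowWord μ) ⟩
  count k (rowWord μ)                           ≡⟨ count-rowWord μ k 1≤k ⟩
  weightAt μ k                                  ∎
  where open ≡-Reasoning

nuT-semistandard : ∀ μ {la Q} → IsStandard (sum μ) la Q →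
                   (∀ {i j a b} → entry Q i j ≡ just a → entry Q (suc i) j ≡ just b → nu μ a ≢ nu μ b) →
                   IsSemiStandard la μ (nuT μ Q)
nuT-semistandard μ {Q = Q} stdQ@(shapeQ , rowsQ , columnsQ , Q↭) distinctRows =
  trans (nuT-shape μ Q) shapeQ , nuT-rows μ rowsQ , strict , nuT-positive μ (standard-inRange stdQ) , nuT-weight μ {Q} Q↭
  where
  strict : ColumnsRel _<_ (nuT μ Q)
  strict i j _ _ ea′ eb′
    with a , ea , refl ← entry-map-just (nu μ) Q i j ea′
       | b , eb , refl ← entry-map-just (nu μ) Q (suc i) j eb′ =
    ℕₚ.≤∧≢⇒< (nu-mono μ (ℕₚ.<⇒≤ (columnsQ i j a b ea eb))) (distinctRows ea eb)

-- Polynomials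

FinMap : ℕ → Set
FinMap m = Vec (Fin m) m

module _ {m : ℕ} where

  _∘ᶠ_ : FinMap m → FinMap m → FinMap m
  σ ∘ᶠ τ = tabulate (lookup σ ∘ lookup τ)

  Injective : FinMap m → Set
  Injective σ = ∀ {i j} → lookup σ i ≡ lookup σ j → i ≡ j

  lookup-∘ᶠ : ∀ σ τ i → lookup (σ ∘ᶠ τ) i ≡ lookup σ (lookup τ i)
  lookup-∘ᶠ σ τ = Vecₚ.lookup∘tabulate _

  ≡-lookup : ∀ {A : Set} {v w : Vec A m} → (∀ i → lookup v i ≡ lookup w i) → v ≡ w
  ≡-lookup {v = v} {w} eq = trans (sym (Vecₚ.tabulate∘lookup v)) (trans (Vecₚ.tabulate-cong eq) (Vecₚ.tabulate∘lookup w))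

∑-allFin : ∀ {n} (f : Fin n → ℕ) → sum (map f (allFin n)) ≡ ∑ f
∑-allFin {n} f = trans (cong sum (Listₚ.map-tabulate {n = n} id f)) (go f)
  where
  go : ∀ {n} (f : Fin n → ℕ) → sum (List.tabulate f) ≡ ∑ f
  go {zero}  f = refl
  go {suc n} f = cong (f Fin.zero ℕ.+_) (go (f ∘ Fin.suc))

∑-zero : ∀ {n} (f : Fin n → ℕ) → (∀ i → f i ≡ 0) → ∑ f ≡ 0
∑-zero {zero}  f _  = refl
∑-zero {suc n} f f0 rewrite f0 Fin.zero = ∑-zero (f ∘ Fin.suc) (f0 ∘ Fin.suc)

∑-single : ∀ {n} (f : Fin n → ℕ) k → (∀ i → i ≢ k → f i ≡ 0) → ∑ f ≡ f k
∑-single {suc n} f Fin.zero f0 = trans (cong (f Fin.zero ℕ.+_) (∑-zero (f ∘ Fin.suc) (λ i → f0 (Fin.suc i) λ ()))) (ℕₚ.+-identityʳ _)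
∑-single {suc n} f (Fin.suc k) f0 rewrite f0 Fin.zero (λ ()) =
  ∑-single (f ∘ Fin.suc) k (λ i i≢k → f0 (Fin.suc i) (i≢k ∘ Finₚ.suc-injective))

module ListSum {c ℓ} (R : CommutativeSemiring c ℓ) where

  open CommutativeSemiring R hiding (refl; sym; trans; reflexive)
  open CommutativeSemiring R using () renaming (refl to ≈-refl; sym to ≈-sym; trans to ≈-trans; reflexive to ≈-reflexive)
  open import Algebra.Properties.CommutativeSemigroup +-commutativeSemigroup using (interchange)
  open Permₛ setoid using (foldr-commMonoid)

  private variable
    a b : Level
    A : Set a
    B : Set b

  sumOf : List A → (A → Carrier) → Carrier
  sumOf xs f = List.foldr _+_ 0# (map f xs)

  sumOf-cong-∈ : ∀ (xs : List A) {f g : A → Carrier} → (∀ {x} → x ∈ xs → f x ≈ g x) → sumOf xs f ≈ sumOf xs g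
  sumOf-cong-∈ []       _  = ≈-refl
  sumOf-cong-∈ (x ∷ xs) eq = +-cong (eq (here refl)) (sumOf-cong-∈ xs (eq ∘ there))

  sumOf-cong : ∀ (xs : List A) {f g : A → Carrier} → (∀ x → f x ≈ g x) → sumOf xs f ≈ sumOf xs g
  sumOf-cong xs eq = sumOf-cong-∈ xs (λ {x} _ → eq x)

  sumOf-zero : ∀ (xs : List A) (f : A → Carrier) → (∀ x → f x ≈ 0#) → sumOf xs f ≈ 0#
  sumOf-zero []       f _  = ≈-refl
  sumOf-zero (x ∷ xs) f f0 = ≈-trans (+-cong (f0 x) (sumOf-zero xs f f0)) (+-identityʳ 0#)

  sumOf-+ : ∀ (xs : List A) (f g : A → Carrier) → sumOf xs (λ x → f x + g x) ≈ sumOf xs f + sumOf xs g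
  sumOf-+ []       f g = ≈-sym (+-identityʳ 0#)
  sumOf-+ (x ∷ xs) f g = ≈-trans (+-congˡ (sumOf-+ xs f g)) (interchange _ _ _ _)

  sumOf-* : ∀ (xs : List A) k (f : A → Carrier) → sumOf xs (λ x → k * f x) ≈ k * sumOf xs f
  sumOf-* []       k f = ≈-sym (zeroʳ k)
  sumOf-* (x ∷ xs) k f = ≈-trans (+-congˡ (sumOf-* xs k f)) (≈-sym (distribˡ k _ _))

  sumOf-++ : ∀ (xs ys : List A) (f : A → Carrier) → sumOf (xs ++ ys) f ≈ sumOf xs f + sumOf ys f
  sumOf-++ []       ys f = ≈-sym (+-identityˡ _)
  sumOf-++ (x ∷ xs) ys f = ≈-trans (+-congˡ (sumOf-++ xs ys f)) (≈-sym (+-assoc _ _ _))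

  sumOf-↭ : ∀ {xs ys : List A} (f : A → Carrier) → xs ↭ ys → sumOf xs f ≈ sumOf ys f
  sumOf-↭ f xs↭ys = foldr-commMonoid +-isCommutativeMonoid (↭⇒↭ₛ′ isEquivalence (Permₚ.map⁺ f xs↭ys))

  sumOf-comm : (xs : List A) (ys : List B) (h : A → B → Carrier) →
               sumOf xs (λ x → sumOf ys (h x)) ≈ sumOf ys (λ y → sumOf xs (λ x → h x y))
  sumOf-comm []       ys h = ≈-sym (sumOf-zero ys _ (λ _ → ≈-refl))
  sumOf-comm (x ∷ xs) ys h = ≈-trans (+-congˡ (sumOf-comm xs ys h)) (≈-sym (sumOf-+ ys (h x) _))

  sumOf-map : (g : A → B) (xs : List A) (f : B → Carrier) → sumOf (map g xs) f ≈ sumOf xs (f ∘ g)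
  sumOf-map g xs f = ≈-reflexive (cong (List.foldr _+_ 0#) (sym (Listₚ.map-∘ xs)))

  sumOf-concatMap : (F : A → List B) (xs : List A) (f : B → Carrier) →
                    sumOf (concatMap F xs) f ≈ sumOf xs (λ x → sumOf (F x) f)
  sumOf-concatMap F []       f = ≈-refl
  sumOf-concatMap F (x ∷ xs) f = ≈-trans (sumOf-++ (F x) (concatMap F xs) f) (+-congˡ (sumOf-concatMap F xs f))

module Symmetrizer {c ℓ} (K : CharZeroField c ℓ) (m : ℕ) where

  ifEq : Fin m → Fin m → ℕ → ℕ
  ifEq k j n = if does (k Finₚ.≟ j) then n else 0

  ifEq-refl : ∀ k n → ifEq k k n ≡ n
  ifEq-refl k n = cong (if_then n else 0) (dec-true (k Finₚ.≟ k) refl)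

  ifEq-≢ : ∀ {k j} n → k ≢ j → ifEq k j n ≡ 0
  ifEq-≢ {k} {j} n k≢j = cong (if_then n else 0) (dec-false (k Finₚ.≟ j) k≢j)

  ifEq-zero : ∀ k j → ifEq k j 0 ≡ 0
  ifEq-zero k j with does (k Finₚ.≟ j)
  ... | true  = refl
  ... | false = refl

  ifEq-+ : ∀ k j a b → ifEq k j (a ℕ.+ b) ≡ ifEq k j a ℕ.+ ifEq k j b
  ifEq-+ k j a b with does (k Finₚ.≟ j)
  ... | true  = refl
  ... | false = refl

  ifEq-sum : ∀ k j (f : Fin m → ℕ) → ifEq k j (∑ f) ≡ ∑ (λ i → ifEq k j (f i))
  ifEq-sum k j f with does (k Finₚ.≟ j)
  ... | true  = refl
  ... | false = sym (∑-zero {m} (λ _ → 0) (λ _ → refl))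

  ifEq-sym : ∀ k j n → ifEq k j n ≡ ifEq j k n
  ifEq-sym k j n with k Finₚ.≟ j
  ... | yes refl = sym (ifEq-refl k n)
  ... | no k≢j   = sym (ifEq-≢ n (k≢j ∘ sym))

  push′ : FinMap m → Vec ℕ m → Vec ℕ m
  push′ = pushExp K m

  lookup-push : ∀ σ e j → lookup (push′ σ e) j ≡ ∑ (λ i → ifEq (lookup σ i) j (lookup e i))
  lookup-push σ e j = trans (Vecₚ.lookup∘tabulate _ j) (∑-allFin {m} _)

  push-zipWith : ∀ σ e f → push′ σ (zipWith ℕ._+_ e f) ≡ zipWith ℕ._+_ (push′ σ e) (push′ σ f)
  push-zipWith σ e f = ≡-lookup λ j → begin
    lookup (push′ σ (zipWith ℕ._+_ e f)) j
      ≡⟨ lookup-push σ (zipWith ℕ._+_ e f) j ⟩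
    ∑ (λ i → ifEq (lookup σ i) j (lookup (zipWith ℕ._+_ e f) i))
      ≡⟨ sum-cong-≗ (λ i → trans (cong (ifEq (lookup σ i) j) (Vecₚ.lookup-zipWith ℕ._+_ i e f)) (ifEq-+ (lookup σ i) j _ _)) ⟩
    ∑ (λ i → ifEq (lookup σ i) j (lookup e i) ℕ.+ ifEq (lookup σ i) j (lookup f i))
      ≡⟨ ∑-distrib-+ (λ i → ifEq (lookup σ i) j (lookup e i)) (λ i → ifEq (lookup σ i) j (lookup f i)) ⟩
    ∑ (λ i → ifEq (lookup σ i) j (lookup e i)) ℕ.+ ∑ (λ i → ifEq (lookup σ i) j (lookup f i))
      ≡⟨ cong₂ ℕ._+_ (lookup-push σ e j) (lookup-push σ f j) ⟨
    lookup (push′ σ e) j ℕ.+ lookup (push′ σ f) j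
      ≡⟨ Vecₚ.lookup-zipWith ℕ._+_ j (push′ σ e) (push′ σ f) ⟨
    lookup (zipWith ℕ._+_ (push′ σ e) (push′ σ f)) j ∎
    where open ≡-Reasoning

  push-zero : ∀ σ → push′ σ (Vec.replicate m 0) ≡ Vec.replicate m 0
  push-zero σ = ≡-lookup λ j → begin
    lookup (push′ σ (Vec.replicate m 0)) j             ≡⟨ lookup-push σ (Vec.replicate m 0) j ⟩
    ∑ (λ i → ifEq (lookup σ i) j (lookup (Vec.replicate m 0) i))
      ≡⟨ ∑-zero _ (λ i → trans (cong (ifEq (lookup σ i) j) (Vecₚ.lookup-replicate i 0)) (ifEq-zero (lookup σ i) j)) ⟩
    0                            ≡⟨ Vecₚ.lookup-replicate j 0 ⟨
    lookup (Vec.replicate m 0) j ∎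
    where open ≡-Reasoning

  push-∘ : ∀ σ τ e → push′ σ (push′ τ e) ≡ push′ (σ ∘ᶠ τ) e
  push-∘ σ τ e = ≡-lookup λ l → begin
    lookup (push′ σ (push′ τ e)) l
      ≡⟨ lookup-push σ (push′ τ e) l ⟩
    ∑ (λ j → ifEq (lookup σ j) l (lookup (push′ τ e) j))
      ≡⟨ sum-cong-≗ (λ j → trans (cong (ifEq (lookup σ j) l) (lookup-push τ e j)) (ifEq-sum (lookup σ j) l _)) ⟩
    ∑ (λ j → ∑ (λ i → ifEq (lookup σ j) l (ifEq (lookup τ i) j (lookup e i))))
      ≡⟨ ∑-comm {m} {m} _ ⟩
    ∑ (λ i → ∑ (λ j → ifEq (lookup σ j) l (ifEq (lookup τ i) j (lookup e i))))
      ≡⟨ sum-cong-≗ (λ i → ∑-single _ (lookup τ i) (λ j j≢τi →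
           trans (cong (ifEq (lookup σ j) l) (ifEq-≢ _ (j≢τi ∘ sym))) (ifEq-zero (lookup σ j) l))) ⟩
    ∑ (λ i → ifEq (lookup σ (lookup τ i)) l (ifEq (lookup τ i) (lookup τ i) (lookup e i)))
      ≡⟨ sum-cong-≗ (λ i → cong₂ (λ k → ifEq k l) (sym (lookup-∘ᶠ σ τ i)) (ifEq-refl (lookup τ i) (lookup e i))) ⟩
    ∑ (λ i → ifEq (lookup (σ ∘ᶠ τ) i) l (lookup e i))
      ≡⟨ lookup-push (σ ∘ᶠ τ) e l ⟨
    lookup (push′ (σ ∘ᶠ τ) e) l ∎
    where open ≡-Reasoning

  unitExp : ℕ → Vec ℕ m
  unitExp x = tabulate (λ i → if suc (toℕ i) ≡ᵇ x then 1 else 0)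

  lookup-unitExp : ∀ k i → lookup (unitExp (suc (toℕ k))) i ≡ ifEq i k 1
  lookup-unitExp k i = trans (Vecₚ.lookup∘tabulate _ i) (cong (if_then 1 else 0) (agree (i Finₚ.≟ k)))
    where
    agree : (d : Dec (i ≡ k)) → does (toℕ i ℕₚ.≟ toℕ k) ≡ does d
    agree (yes i≡k) = dec-true (toℕ i ℕₚ.≟ toℕ k) (cong toℕ i≡k)
    agree (no i≢k)  = dec-false (toℕ i ℕₚ.≟ toℕ k) (i≢k ∘ Finₚ.toℕ-injective)

  unitExp-outside : ∀ x → (∀ (i : Fin m) → suc (toℕ i) ≢ x) → unitExp x ≡ Vec.replicate m 0
  unitExp-outside x outside = ≡-lookup λ i →
    trans (Vecₚ.lookup∘tabulate _ i)
      (trans (cong (if_then 1 else 0) (dec-false (suc (toℕ i) ℕₚ.≟ x) (outside i))) (sym (Vecₚ.lookup-replicate i 0)))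

  -- σ acting on the variable indices 1, …, m, and trivially on all other numbers
  applyIndex : FinMap m → ℕ → ℕ
  applyIndex σ zero = zero
  applyIndex σ (suc x) with x ℕ.<? m
  ... | yes x<m = suc (toℕ (lookup σ (Fin.fromℕ< x<m)))
  ... | no _    = suc x

  push-unitExp-index : ∀ σ k → push′ σ (unitExp (suc (toℕ k))) ≡ unitExp (suc (toℕ (lookup σ k)))
  push-unitExp-index σ k = ≡-lookup λ j → begin
    lookup (push′ σ (unitExp (suc (toℕ k)))) j
      ≡⟨ lookup-push σ (unitExp (suc (toℕ k))) j ⟩
    ∑ (λ i → ifEq (lookup σ i) j (lookup (unitExp (suc (toℕ k))) i))
      ≡⟨ sum-cong-≗ (λ i → cong (ifEq (lookup σ i) j) (lookup-unitExp k i)) ⟩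
    ∑ (λ i → ifEq (lookup σ i) j (ifEq i k 1))
      ≡⟨ ∑-single _ k (λ i i≢k → trans (cong (ifEq (lookup σ i) j) (ifEq-≢ 1 i≢k)) (ifEq-zero (lookup σ i) j)) ⟩
    ifEq (lookup σ k) j (ifEq k k 1)
      ≡⟨ trans (cong (ifEq (lookup σ k) j) (ifEq-refl k 1)) (ifEq-sym (lookup σ k) j 1) ⟩
    ifEq j (lookup σ k) 1
      ≡⟨ lookup-unitExp (lookup σ k) j ⟨
    lookup (unitExp (suc (toℕ (lookup σ k)))) j ∎
    where open ≡-Reasoning

  push-unitExp : ∀ σ x → push′ σ (unitExp x) ≡ unitExp (applyIndex σ x)
  push-unitExp σ zero = trans (cong (push′ σ) (unitExp-outside 0 (λ _ ()))) (trans (push-zero σ) (sym (unitExp-outside 0 (λ _ ()))))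
  push-unitExp σ (suc x) with x ℕ.<? m
  ... | yes x<m = subst (λ y → push′ σ (unitExp (suc y)) ≡ unitExp (suc (toℕ (lookup σ k)))) (Finₚ.toℕ-fromℕ< x<m) (push-unitExp-index σ k)
    where k = Fin.fromℕ< x<m
  ... | no x≮m  = trans (cong (push′ σ) zeroExp) (trans (push-zero σ) (sym zeroExp))
    where
    zeroExp : unitExp (suc x) ≡ Vec.replicate m 0
    zeroExp = unitExp-outside (suc x) (λ i eq → x≮m (subst (ℕ._< m) (ℕₚ.suc-injective eq) (Finₚ.toℕ<n i)))

  pull : FinMap m → Vec ℕ m → Vec ℕ m
  pull σ e = tabulate (lookup e ∘ lookup σ)

  pull-push : ∀ σ → Injective σ → ∀ v → pull σ (push′ σ v) ≡ v
  pull-push σ inj v = ≡-lookup λ k → begin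
    lookup (pull σ (push′ σ v)) k   ≡⟨ Vecₚ.lookup∘tabulate _ k ⟩
    lookup (push′ σ v) (lookup σ k) ≡⟨ lookup-push σ v (lookup σ k) ⟩
    ∑ (λ i → ifEq (lookup σ i) (lookup σ k) (lookup v i))
      ≡⟨ ∑-single _ k (λ i i≢k → ifEq-≢ (lookup v i) (i≢k ∘ inj)) ⟩
    ifEq (lookup σ k) (lookup σ k) (lookup v k) ≡⟨ ifEq-refl (lookup σ k) (lookup v k) ⟩
    lookup v k                                  ∎
    where open ≡-Reasoning

  +∸-cancel : ∀ {v w e : Vec ℕ m} → zipWith ℕ._+_ v w ≡ e → zipWith ℕ._∸_ e v ≡ w
  +∸-cancel {v} {w} refl = ≡-lookup λ i → begin
    lookup (zipWith ℕ._∸_ (zipWith ℕ._+_ v w) v) i ≡⟨ Vecₚ.lookup-zipWith ℕ._∸_ i (zipWith ℕ._+_ v w) v ⟩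
    lookup (zipWith ℕ._+_ v w) i ℕ.∸ lookup v i    ≡⟨ cong (ℕ._∸ lookup v i) (Vecₚ.lookup-zipWith ℕ._+_ i v w) ⟩
    lookup v i ℕ.+ lookup w i ℕ.∸ lookup v i       ≡⟨ ℕₚ.m+n∸m≡n (lookup v i) (lookup w i) ⟩
    lookup w i                                     ∎
    where open ≡-Reasoning

  open CharZeroField K hiding (refl; sym; trans; reflexive)
  open CharZeroField K using () renaming (refl to ≈-refl; sym to ≈-sym; trans to ≈-trans; reflexive to ≈-reflexive)
  module ≈-Reasoning = Relation.Binary.Reasoning.Setoid setoid
  open import Algebra.Properties.Ring ring using (-1*x≈-x; -‿involutive)
  open import Algebra.Properties.CommutativeSemigroup *-commutativeSemigroup using (x∙yz≈y∙xz)
  open ListSum commutativeSemiring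

  𝒫 : Set c
  𝒫 = Poly K m

  Term : Set c
  Term = Carrier × Vec ℕ m

  infix  4 _≋_
  infixl 6 _⊕_
  infixl 7 _⊗_
  infixr 8 _⊙_

  record _≋_ (p q : 𝒫) : Set ℓ where
    constructor coeffwise
    field coeff-≈ : _≈P_ K m p q
  open _≋_

  _⊕_ : 𝒫 → 𝒫 → 𝒫
  _⊕_ = _+P_ K m

  _⊗_ : 𝒫 → 𝒫 → 𝒫
  _⊗_ = _*P_ K m

  _⊙_ : Carrier → 𝒫 → 𝒫
  _⊙_ = _·P_ K m

  coeff′ : 𝒫 → Vec ℕ m → Carrier
  coeff′ = coeff K m

  ≋-setoid : Setoid c ℓ
  ≋-setoid = record
    { Carrier       = 𝒫
    ; _≈_           = _≋_
    ; isEquivalence = record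
      { refl  = coeffwise λ _ → ≈-refl
      ; sym   = λ p≋q → coeffwise λ e → ≈-sym (coeff-≈ p≋q e)
      ; trans = λ p≋q q≋r → coeffwise λ e → ≈-trans (coeff-≈ p≋q e) (coeff-≈ q≋r e)
      }
    }

  _≟ᵛ_ : (v w : Vec ℕ m) → Dec (v ≡ w)
  _≟ᵛ_ = Vecₚ.≡-dec ℕₚ._≟_

  open Setoid ≋-setoid public using () renaming (refl to ≋-refl; sym to ≋-sym; trans to ≋-trans)

  coeffOfTerm : Vec ℕ m → Term → Carrier
  coeffOfTerm e (a , v) = if does (v ≟ᵛ e) then a else 0#

  coeff-sumOf : ∀ p e → coeff′ p e ≈ sumOf p (coeffOfTerm e)
  coeff-sumOf []      e = ≈-refl
  coeff-sumOf (t ∷ p) e with does (proj₂ t ≟ᵛ e)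
  ... | true  = +-congˡ (coeff-sumOf p e)
  ... | false = ≈-trans (coeff-sumOf p e) (≈-sym (+-identityˡ _))

  coeffOfTerm-cong : ∀ e v {a a′} → a ≈ a′ → coeffOfTerm e (a , v) ≈ coeffOfTerm e (a′ , v)
  coeffOfTerm-cong e v a≈a′ with does (v ≟ᵛ e)
  ... | true  = a≈a′
  ... | false = ≈-refl

  coeffOfTerm-* : ∀ e k a v → coeffOfTerm e (k * a , v) ≈ k * coeffOfTerm e (a , v)
  coeffOfTerm-* e k a v with does (v ≟ᵛ e)
  ... | true  = ≈-refl
  ... | false = ≈-sym (zeroʳ k)

  coeff-⊕ : ∀ p q e → coeff′ (p ⊕ q) e ≈ coeff′ p e + coeff′ q e
  coeff-⊕ p q e = ≈-trans (coeff-sumOf (p ⊕ q) e)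
    (≈-trans (sumOf-++ p q (coeffOfTerm e)) (≈-sym (+-cong (coeff-sumOf p e) (coeff-sumOf q e))))

  coeff-sumP : ∀ ps e → coeff′ (sumP K m ps) e ≈ sumOf ps (λ p → coeff′ p e)
  coeff-sumP []       e = ≈-refl
  coeff-sumP (p ∷ ps) e = ≈-trans (coeff-⊕ p (sumP K m ps) e) (+-congˡ (coeff-sumP ps e))

  coeff-⊙ : ∀ k p e → coeff′ (k ⊙ p) e ≈ k * coeff′ p e
  coeff-⊙ k p e = begin
    coeff′ (k ⊙ p) e              ≈⟨ coeff-sumOf (k ⊙ p) e ⟩
    sumOf (k ⊙ p) (coeffOfTerm e) ≈⟨ sumOf-map _ p (coeffOfTerm e) ⟩
    sumOf p (λ t → coeffOfTerm e (k * proj₁ t , proj₂ t)) ≈⟨ sumOf-cong p (λ t → coeffOfTerm-* e k (proj₁ t) (proj₂ t)) ⟩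
    sumOf p (λ t → k * coeffOfTerm e t) ≈⟨ sumOf-* p k (coeffOfTerm e) ⟩
    k * sumOf p (coeffOfTerm e)         ≈⟨ *-congˡ (coeff-sumOf p e) ⟨
    k * coeff′ p e                      ∎
    where open ≈-Reasoning

  _⊠_ : Term → Term → Term
  (a , v) ⊠ (b , w) = a * b , zipWith ℕ._+_ v w

  coeff-⊗ : ∀ p q e → coeff′ (p ⊗ q) e ≈ sumOf p (λ s → sumOf q (λ t → coeffOfTerm e (s ⊠ t)))
  coeff-⊗ p q e = begin
    coeff′ (p ⊗ q) e              ≈⟨ coeff-sumOf (p ⊗ q) e ⟩
    sumOf (p ⊗ q) (coeffOfTerm e) ≈⟨ sumOf-concatMap (λ s → map (s ⊠_) q) p (coeffOfTerm e) ⟩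
    sumOf p (λ s → sumOf (map (s ⊠_) q) (coeffOfTerm e)) ≈⟨ sumOf-cong p (λ s → sumOf-map (s ⊠_) q (coeffOfTerm e)) ⟩
    sumOf p (λ s → sumOf q (λ t → coeffOfTerm e (s ⊠ t))) ∎
    where open ≈-Reasoning

  ⊙-congˡ : ∀ k {p p′} → p ≋ p′ → k ⊙ p ≋ k ⊙ p′
  ⊙-congˡ k {p} {p′} p≋p′ = coeffwise λ e →
    ≈-trans (coeff-⊙ k p e) (≈-trans (*-congˡ (coeff-≈ p≋p′ e)) (≈-sym (coeff-⊙ k p′ e)))

  coeffOfTerm-≡ : ∀ e a {v v′} → v ≡ v′ → coeffOfTerm e (a , v) ≈ coeffOfTerm e (a , v′)
  coeffOfTerm-≡ e a refl = ≈-refl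

  ⊗-comm : ∀ p q → p ⊗ q ≋ q ⊗ p
  ⊗-comm p q = coeffwise λ e → begin
    coeff′ (p ⊗ q) e                             ≈⟨ coeff-⊗ p q e ⟩
    sumOf p (λ s → sumOf q (λ t → coeffOfTerm e (s ⊠ t))) ≈⟨ sumOf-comm p q (λ s t → coeffOfTerm e (s ⊠ t)) ⟩
    sumOf q (λ t → sumOf p (λ s → coeffOfTerm e (s ⊠ t))) ≈⟨ sumOf-cong q (λ t → sumOf-cong p (λ s → ⊠-comm e s t)) ⟩
    sumOf q (λ t → sumOf p (λ s → coeffOfTerm e (t ⊠ s))) ≈⟨ coeff-⊗ q p e ⟨
    coeff′ (q ⊗ p) e                             ∎
    where
    open ≈-Reasoning
    ⊠-comm : ∀ e s t → coeffOfTerm e (s ⊠ t) ≈ coeffOfTerm e (t ⊠ s)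
    ⊠-comm e (a , v) (b , w) = ≈-trans (coeffOfTerm-≡ e (a * b) (Vecₚ.zipWith-comm ℕₚ.+-comm v w)) (coeffOfTerm-cong e (zipWith ℕ._+_ w v) (*-comm a b))

  ⊗-assoc : ∀ p q r → (p ⊗ q) ⊗ r ≋ p ⊗ (q ⊗ r)
  ⊗-assoc p q r = coeffwise λ e → begin
    coeff′ ((p ⊗ q) ⊗ r) e
      ≈⟨ coeff-⊗ (p ⊗ q) r e ⟩
    sumOf (p ⊗ q) (λ u → sumOf r (λ w → coeffOfTerm e (u ⊠ w)))
      ≈⟨ sumOf-concatMap (λ s → map (s ⊠_) q) p _ ⟩
    sumOf p (λ s → sumOf (map (s ⊠_) q) (λ u → sumOf r (λ w → coeffOfTerm e (u ⊠ w))))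
      ≈⟨ sumOf-cong p (λ s → sumOf-map (s ⊠_) q _) ⟩
    sumOf p (λ s → sumOf q (λ t → sumOf r (λ w → coeffOfTerm e ((s ⊠ t) ⊠ w))))
      ≈⟨ sumOf-cong p (λ s → sumOf-cong q (λ t → sumOf-cong r (λ w → ⊠-assoc e s t w))) ⟩
    sumOf p (λ s → sumOf q (λ t → sumOf r (λ w → coeffOfTerm e (s ⊠ (t ⊠ w)))))
      ≈⟨ sumOf-cong p (λ s → ≈-trans (sumOf-concatMap (λ t → map (t ⊠_) r) q _) (sumOf-cong q (λ t → sumOf-map (t ⊠_) r _))) ⟨
    sumOf p (λ s → sumOf (q ⊗ r) (λ v → coeffOfTerm e (s ⊠ v)))
      ≈⟨ coeff-⊗ p (q ⊗ r) e ⟨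
    coeff′ (p ⊗ (q ⊗ r)) e ∎
    where
    open ≈-Reasoning
    ⊠-assoc : ∀ e s t w → coeffOfTerm e ((s ⊠ t) ⊠ w) ≈ coeffOfTerm e (s ⊠ (t ⊠ w))
    ⊠-assoc e (a , u) (b , v) (d , w) =
      ≈-trans (coeffOfTerm-≡ e _ (Vecₚ.zipWith-assoc ℕₚ.+-assoc u v w)) (coeffOfTerm-cong e (zipWith ℕ._+_ u (zipWith ℕ._+_ v w)) (*-assoc a b d))

  -- x^v x^w = x^e forces w = e ∸ v, which is possible only if v + (e ∸ v) = e.
  coeffOfTerm-⊠-fits : ∀ e a v t → zipWith ℕ._+_ v (zipWith ℕ._∸_ e v) ≡ e → coeffOfTerm e ((a , v) ⊠ t) ≈ a * coeffOfTerm (zipWith ℕ._∸_ e v) t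
  coeffOfTerm-⊠-fits e a v (b , w) fits with w ≟ᵛ zipWith ℕ._∸_ e v
  ... | yes refl = ≈-reflexive (cong (if_then a * b else 0#) (dec-true (zipWith ℕ._+_ v w ≟ᵛ e) fits))
  ... | no w≢    = ≈-trans (≈-reflexive (cong (if_then a * b else 0#) (dec-false (zipWith ℕ._+_ v w ≟ᵛ e) (w≢ ∘ sym ∘ +∸-cancel))))
                           (≈-sym (zeroʳ a))

  coeffOfTerm-⊠-misfits : ∀ e a v t → zipWith ℕ._+_ v (zipWith ℕ._∸_ e v) ≢ e → coeffOfTerm e ((a , v) ⊠ t) ≈ 0#
  coeffOfTerm-⊠-misfits e a v (b , w) misfits =
    ≈-reflexive (cong (if_then a * b else 0#) (dec-false (zipWith ℕ._+_ v w ≟ᵛ e)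
      (λ eq → misfits (subst (λ u → zipWith ℕ._+_ v u ≡ e) (sym (+∸-cancel eq)) eq))))

  ⊗-congˡ : ∀ p {q q′} → q ≋ q′ → p ⊗ q ≋ p ⊗ q′
  ⊗-congˡ p {q} {q′} q≋q′ = coeffwise λ e → begin
    coeff′ (p ⊗ q) e                                      ≈⟨ coeff-⊗ p q e ⟩
    sumOf p (λ s → sumOf q (λ t → coeffOfTerm e (s ⊠ t))) ≈⟨ sumOf-cong p (termwise e) ⟩
    sumOf p (λ s → sumOf q′ (λ t → coeffOfTerm e (s ⊠ t))) ≈⟨ coeff-⊗ p q′ e ⟨
    coeff′ (p ⊗ q′) e                             ∎
    where
    open ≈-Reasoning
    termwise : ∀ e s → sumOf q (λ t → coeffOfTerm e (s ⊠ t)) ≈ sumOf q′ (λ t → coeffOfTerm e (s ⊠ t))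
    termwise e (a , v) with zipWith ℕ._+_ v (zipWith ℕ._∸_ e v) ≟ᵛ e
    ... | yes fits = begin
      sumOf q (λ t → coeffOfTerm e ((a , v) ⊠ t))  ≈⟨ sumOf-cong q (λ t → coeffOfTerm-⊠-fits e a v t fits) ⟩
      sumOf q (λ t → a * coeffOfTerm d t)          ≈⟨ sumOf-* q a (coeffOfTerm d) ⟩
      a * sumOf q (coeffOfTerm d)                  ≈⟨ *-congˡ (≈-trans (≈-sym (coeff-sumOf q d)) (≈-trans (coeff-≈ q≋q′ d) (coeff-sumOf q′ d))) ⟩
      a * sumOf q′ (coeffOfTerm d)                 ≈⟨ sumOf-* q′ a (coeffOfTerm d) ⟨
      sumOf q′ (λ t → a * coeffOfTerm d t)         ≈⟨ sumOf-cong q′ (λ t → coeffOfTerm-⊠-fits e a v t fits) ⟨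
      sumOf q′ (λ t → coeffOfTerm e ((a , v) ⊠ t)) ∎
      where d = zipWith ℕ._∸_ e v
    ... | no misfits = ≈-trans (sumOf-zero q _ (λ t → coeffOfTerm-⊠-misfits e a v t misfits))
                               (≈-sym (sumOf-zero q′ _ (λ t → coeffOfTerm-⊠-misfits e a v t misfits)))

  ⊗-congʳ : ∀ {p p′} q → p ≋ p′ → p ⊗ q ≋ p′ ⊗ q
  ⊗-congʳ {p} {p′} q p≋p′ = ≋-trans (⊗-comm p q) (≋-trans (⊗-congˡ q p≋p′) (⊗-comm q p′))

  𝟙 : 𝒫
  𝟙 = 1P K m

  ∏ : List 𝒫 → 𝒫
  ∏ = prodP K m

  zeroExp-+ : ∀ v → zipWith ℕ._+_ (Vec.replicate m 0) v ≡ v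
  zeroExp-+ v = ≡-lookup λ i → trans (Vecₚ.lookup-zipWith ℕ._+_ i (Vec.replicate m 0) v) (cong (ℕ._+ lookup v i) (Vecₚ.lookup-replicate i 0))

  ⊗-identityˡ : ∀ q → 𝟙 ⊗ q ≋ q
  ⊗-identityˡ q = coeffwise λ e → begin
    coeff′ (𝟙 ⊗ q) e                                                  ≈⟨ coeff-⊗ 𝟙 q e ⟩
    sumOf q (λ t → coeffOfTerm e ((1# , Vec.replicate m 0) ⊠ t)) + 0# ≈⟨ +-identityʳ _ ⟩
    sumOf q (λ t → coeffOfTerm e ((1# , Vec.replicate m 0) ⊠ t))      ≈⟨ sumOf-cong q (unit e) ⟩
    sumOf q (coeffOfTerm e)                                           ≈⟨ coeff-sumOf q e ⟨
    coeff′ q e                                                        ∎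
    where
    open ≈-Reasoning
    unit : ∀ e t → coeffOfTerm e ((1# , Vec.replicate m 0) ⊠ t) ≈ coeffOfTerm e t
    unit e (b , w) = ≈-trans (coeffOfTerm-≡ e (1# * b) (zeroExp-+ w)) (coeffOfTerm-cong e w (*-identityˡ b))

  ⊗-isCommutativeMonoid : IsCommutativeMonoid _≋_ _⊗_ 𝟙
  ⊗-isCommutativeMonoid = record
    { isMonoid = record
      { isSemigroup = record
        { isMagma = record
          { isEquivalence = Setoid.isEquivalence ≋-setoid
          ; ∙-cong        = λ {p} {p′} {q} p≋p′ q≋q′ → ≋-trans (⊗-congʳ q p≋p′) (⊗-congˡ p′ q≋q′)
          }
        ; assoc = ⊗-assoc
        }
      ; identity = ⊗-identityˡ , λ q → ≋-trans (⊗-comm q 𝟙) (⊗-identityˡ q)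
      }
    ; comm = ⊗-comm
    }

  ∏-++ : ∀ ps qs → ∏ (ps ++ qs) ≋ ∏ ps ⊗ ∏ qs
  ∏-++ []       qs = ≋-sym (⊗-identityˡ (∏ qs))
  ∏-++ (p ∷ ps) qs = ≋-trans (⊗-congˡ p (∏-++ ps qs)) (≋-sym (⊗-assoc p (∏ ps) (∏ qs)))

  ∏-↭ : ∀ {ps qs} → ps ↭ qs → ∏ ps ≋ ∏ qs
  ∏-↭ ps↭qs = ≋-Perm.foldr-commMonoid ⊗-isCommutativeMonoid (↭⇒↭ₛ′ (Setoid.isEquivalence ≋-setoid) ps↭qs)
    where module ≋-Perm = Permₛ ≋-setoid

  ⊙-⊗ : ∀ k p q → (k ⊙ p) ⊗ q ≋ k ⊙ (p ⊗ q)
  ⊙-⊗ k p q = coeffwise λ e → begin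
    coeff′ ((k ⊙ p) ⊗ q) e                            ≈⟨ coeff-⊗ (k ⊙ p) q e ⟩
    sumOf (k ⊙ p) (λ s → sumOf q (λ t → coeffOfTerm e (s ⊠ t))) ≈⟨ sumOf-map _ p _ ⟩
    sumOf p (λ s → sumOf q (λ t → coeffOfTerm e ((k * proj₁ s , proj₂ s) ⊠ t)))
      ≈⟨ sumOf-cong p (λ s → sumOf-cong q (λ t → scale e s t)) ⟩
    sumOf p (λ s → sumOf q (λ t → k * coeffOfTerm e (s ⊠ t))) ≈⟨ sumOf-cong p (λ s → sumOf-* q k _) ⟩
    sumOf p (λ s → k * sumOf q (λ t → coeffOfTerm e (s ⊠ t))) ≈⟨ sumOf-* p k _ ⟩
    k * sumOf p (λ s → sumOf q (λ t → coeffOfTerm e (s ⊠ t))) ≈⟨ *-congˡ (coeff-⊗ p q e) ⟨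
    k * coeff′ (p ⊗ q) e                                      ≈⟨ coeff-⊙ k (p ⊗ q) e ⟨
    coeff′ (k ⊙ (p ⊗ q)) e                                    ∎
    where
    open ≈-Reasoning
    scale : ∀ e s t → coeffOfTerm e ((k * proj₁ s , proj₂ s) ⊠ t) ≈ k * coeffOfTerm e (s ⊠ t)
    scale e (a , v) (b , w) = ≈-trans (coeffOfTerm-cong e (zipWith ℕ._+_ v w) (*-assoc k a b)) (coeffOfTerm-* e k (a * b) (zipWith ℕ._+_ v w))

  ⊗-⊙ : ∀ k p q → p ⊗ (k ⊙ q) ≋ k ⊙ (p ⊗ q)
  ⊗-⊙ k p q = ≋-trans (⊗-comm p (k ⊙ q)) (≋-trans (⊙-⊗ k q p) (⊙-congˡ k (⊗-comm q p)))

  act′ : FinMap m → 𝒫 → 𝒫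
  act′ = act K m

  var′ : ℕ → 𝒫
  var′ = var K m

  act-⊕ : ∀ σ p q → act′ σ (p ⊕ q) ≡ act′ σ p ⊕ act′ σ q
  act-⊕ σ = Listₚ.map-++ _

  act-⊙ : ∀ σ k p → act′ σ (k ⊙ p) ≡ k ⊙ act′ σ p
  act-⊙ σ k []      = refl
  act-⊙ σ k (t ∷ p) = cong (_ ∷_) (act-⊙ σ k p)

  act-⊗ : ∀ σ p q → act′ σ (p ⊗ q) ≡ act′ σ p ⊗ act′ σ q
  act-⊗ σ []      q = refl
  act-⊗ σ (s ∷ p) q = trans (Listₚ.map-++ _ (map (s ⊠_) q) (p ⊗ q)) (cong₂ _++_ (row q) (act-⊗ σ p q))
    where
    push-term : Term → Term
    push-term (a , v) = a , push′ σ v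
    row : ∀ q → act′ σ (map (s ⊠_) q) ≡ map (push-term s ⊠_) (act′ σ q)
    row []      = refl
    row (t ∷ q) = cong₂ _∷_ (cong (_ ,_) (push-zipWith σ (proj₂ s) (proj₂ t))) (row q)

  act-∏ : ∀ σ ps → act′ σ (∏ ps) ≡ ∏ (map (act′ σ) ps)
  act-∏ σ []       = cong (λ v → (1# , v) ∷ []) (push-zero σ)
  act-∏ σ (p ∷ ps) = trans (act-⊗ σ p (∏ ps)) (cong (act′ σ p ⊗_) (act-∏ σ ps))

  act-var : ∀ σ x → act′ σ (var′ x) ≡ var′ (applyIndex σ x)
  act-var σ x = cong (λ v → (1# , v) ∷ []) (push-unitExp σ x)

  act-act : ∀ σ τ p → act′ σ (act′ τ p) ≡ act′ (σ ∘ᶠ τ) p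
  act-act σ τ []      = refl
  act-act σ τ (t ∷ p) = cong₂ _∷_ (cong (proj₁ t ,_) (push-∘ σ τ (proj₂ t))) (act-act σ τ p)

  module _ (σ : FinMap m) (inj : Injective σ) (e : Vec ℕ m) where

    -- push σ is injective, so x^(push σ v) = x^e forces v = pull σ e
    coeffOfTerm-push-hit : push′ σ (pull σ e) ≡ e → ∀ a v → coeffOfTerm e (a , push′ σ v) ≈ coeffOfTerm (pull σ e) (a , v)
    coeffOfTerm-push-hit hit a v with v ≟ᵛ pull σ e
    ... | yes refl = ≈-reflexive (cong (if_then a else 0#) (dec-true (push′ σ v ≟ᵛ e) hit))
    ... | no v≢    = ≈-reflexive (cong (if_then a else 0#)
                       (dec-false (push′ σ v ≟ᵛ e) (λ eq → v≢ (trans (sym (pull-push σ inj v)) (cong (pull σ) eq)))))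

    coeffOfTerm-push-miss : push′ σ (pull σ e) ≢ e → ∀ a v → coeffOfTerm e (a , push′ σ v) ≈ 0#
    coeffOfTerm-push-miss miss a v = ≈-reflexive (cong (if_then a else 0#)
      (dec-false (push′ σ v ≟ᵛ e) (λ eq → miss (subst (λ u → push′ σ (pull σ u) ≡ u) eq (cong (push′ σ) (pull-push σ inj v))))))

    coeff-act : ∀ p → push′ σ (pull σ e) ≡ e → coeff′ (act′ σ p) e ≈ coeff′ p (pull σ e)
    coeff-act p hit = begin
      coeff′ (act′ σ p) e              ≈⟨ coeff-sumOf (act′ σ p) e ⟩
      sumOf (act′ σ p) (coeffOfTerm e) ≈⟨ sumOf-map _ p (coeffOfTerm e) ⟩
      sumOf p (λ t → coeffOfTerm e (proj₁ t , push′ σ (proj₂ t))) ≈⟨ sumOf-cong p (λ t → coeffOfTerm-push-hit hit (proj₁ t) (proj₂ t)) ⟩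
      sumOf p (coeffOfTerm (pull σ e)) ≈⟨ coeff-sumOf p (pull σ e) ⟨
      coeff′ p (pull σ e)              ∎
      where open ≈-Reasoning

    coeff-act-zero : ∀ p → push′ σ (pull σ e) ≢ e → coeff′ (act′ σ p) e ≈ 0#
    coeff-act-zero p miss = ≈-trans (coeff-sumOf (act′ σ p) e)
      (≈-trans (sumOf-map _ p (coeffOfTerm e)) (sumOf-zero p _ (λ t → coeffOfTerm-push-miss miss (proj₁ t) (proj₂ t))))

  act-cong : ∀ σ → Injective σ → ∀ {p q} → p ≋ q → act′ σ p ≋ act′ σ q
  act-cong σ inj {p} {q} p≋q = coeffwise coeffs
    where
    coeffs : ∀ e → coeff′ (act′ σ p) e ≈ coeff′ (act′ σ q) e
    coeffs e with push′ σ (pull σ e) ≟ᵛ e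
    ... | yes hit = ≈-trans (coeff-act σ inj e p hit) (≈-trans (coeff-≈ p≋q (pull σ e)) (≈-sym (coeff-act σ inj e q hit)))
    ... | no miss = ≈-trans (coeff-act-zero σ inj e p miss) (≈-sym (coeff-act-zero σ inj e q miss))

  _−_ : 𝒫 → 𝒫 → 𝒫
  _−_ = _-P_ K m

  pairs′ : List ℕ → List (ℕ × ℕ)
  pairs′ = pairs K m

  columns′ : Tableau → List (List ℕ)
  columns′ = columns K m

  specht′ : Tableau → 𝒫
  specht′ = specht K m

  difference : ℕ × ℕ → 𝒫
  difference (a , b) = var′ a − var′ b

  columnFactors : List ℕ → List 𝒫
  columnFactors col = map difference (pairs′ col)

  columns-relabel : ∀ f T → columns′ (relabel f T) ≡ map (map f) (columns′ T)
  columns-relabel f []      = refl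
  columns-relabel f (r ∷ T) rewrite Listₚ.length-map f r =
    trans (Listₚ.map-cong (column-map f (r ∷ T)) (upTo (length r))) (Listₚ.map-∘ (upTo (length r)))

  pairs-map : ∀ f col → pairs′ (map f col) ≡ map (Product.map f f) (pairs′ col)
  pairs-map f []        = refl
  pairs-map f (a ∷ col) = trans (cong₂ _++_ (trans (sym (Listₚ.map-∘ col)) (Listₚ.map-∘ col)) (pairs-map f col))
                                (sym (Listₚ.map-++ _ (map (a ,_) col) (pairs′ col)))

  act-difference : ∀ σ ab → act′ σ (difference ab) ≡ difference (Product.map (applyIndex σ) (applyIndex σ) ab)
  act-difference σ (a , b) =
    trans (act-⊕ σ (var′ a) ((- 1#) ⊙ var′ b))
          (cong₂ _⊕_ (act-var σ a) (trans (act-⊙ σ (- 1#) (var′ b)) (cong ((- 1#) ⊙_) (act-var σ b))))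

  act-columnFactors : ∀ σ col → map (act′ σ) (columnFactors col) ≡ columnFactors (map (applyIndex σ) col)
  act-columnFactors σ col = begin
    map (act′ σ) (map difference (pairs′ col)) ≡⟨ Listₚ.map-∘ (pairs′ col) ⟨
    map (act′ σ ∘ difference) (pairs′ col)     ≡⟨ Listₚ.map-cong (act-difference σ) (pairs′ col) ⟩
    map (difference ∘ Product.map (applyIndex σ) (applyIndex σ)) (pairs′ col) ≡⟨ Listₚ.map-∘ (pairs′ col) ⟩
    map difference (map _ (pairs′ col))    ≡⟨ cong (map difference) (pairs-map (applyIndex σ) col) ⟨
    columnFactors (map (applyIndex σ) col) ∎
    where open ≡-Reasoning

  act-specht : ∀ σ T → act′ σ (specht′ T) ≡ specht′ (relabel (applyIndex σ) T)
  act-specht σ T = begin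
    act′ σ (∏ (concatMap columnFactors (columns′ T)))
      ≡⟨ act-∏ σ (concatMap columnFactors (columns′ T)) ⟩
    ∏ (map (act′ σ) (concatMap columnFactors (columns′ T)))
      ≡⟨ cong ∏ (Listₚ.map-concatMap (act′ σ) columnFactors (columns′ T)) ⟩
    ∏ (concatMap (map (act′ σ) ∘ columnFactors) (columns′ T))
      ≡⟨ cong ∏ (Listₚ.concatMap-cong (act-columnFactors σ) (columns′ T)) ⟩
    ∏ (concatMap (columnFactors ∘ map (applyIndex σ)) (columns′ T))
      ≡⟨ cong ∏ (Listₚ.concatMap-map columnFactors (map (applyIndex σ)) (columns′ T)) ⟨
    ∏ (concatMap columnFactors (map (map (applyIndex σ)) (columns′ T)))
      ≡⟨ cong (∏ ∘ concatMap columnFactors) (columns-relabel (applyIndex σ) T) ⟨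
    specht′ (relabel (applyIndex σ) T) ∎
    where open ≡-Reasoning


  module ≋-Reasoning = Relation.Binary.Reasoning.Setoid ≋-setoid

  -1·-involutive : ∀ x → (- 1#) * ((- 1#) * x) ≈ x
  -1·-involutive x = ≈-trans (-1*x≈-x _) (≈-trans (-‿cong (-1*x≈-x x)) (-‿involutive x))

  difference-swap : ∀ a b → difference (b , a) ≋ (- 1#) ⊙ difference (a , b)
  difference-swap a b = coeffwise λ e → begin
    coeff′ (var′ b − var′ a) e
      ≈⟨ coeff-⊕ (var′ b) ((- 1#) ⊙ var′ a) e ⟩
    coeff′ (var′ b) e + coeff′ ((- 1#) ⊙ var′ a) e
      ≈⟨ +-congˡ (coeff-⊙ (- 1#) (var′ a) e) ⟩
    coeff′ (var′ b) e + (- 1#) * coeff′ (var′ a) e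
      ≈⟨ +-comm _ _ ⟩
    (- 1#) * coeff′ (var′ a) e + coeff′ (var′ b) e
      ≈⟨ +-congˡ (-1·-involutive _) ⟨
    (- 1#) * coeff′ (var′ a) e + (- 1#) * ((- 1#) * coeff′ (var′ b) e)
      ≈⟨ distribˡ (- 1#) _ _ ⟨
    (- 1#) * (coeff′ (var′ a) e + (- 1#) * coeff′ (var′ b) e)
      ≈⟨ *-congˡ (≈-trans (coeff-⊕ (var′ a) ((- 1#) ⊙ var′ b) e) (+-congˡ (coeff-⊙ (- 1#) (var′ b) e))) ⟨
    (- 1#) * coeff′ (var′ a − var′ b) e
      ≈⟨ coeff-⊙ (- 1#) (var′ a − var′ b) e ⟨
    coeff′ ((- 1#) ⊙ (var′ a − var′ b)) e
      ∎
    where open ≈-Reasoning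

  columnFactors-∷ : ∀ x w → columnFactors (x ∷ w) ≡ map (difference ∘ (x ,_)) w ++ columnFactors w
  columnFactors-∷ x w = trans (Listₚ.map-++ difference (map (x ,_) w) (pairs′ w)) (cong (_++ columnFactors w) (sym (Listₚ.map-∘ w)))

  columnFactors-swap : ∀ u a b v → ∏ (columnFactors (u ++ b ∷ a ∷ v)) ≋ (- 1#) ⊙ ∏ (columnFactors (u ++ a ∷ b ∷ v))
  columnFactors-swap [] a b v = begin
    difference (b , a) ⊗ ∏ (map difference X) ≈⟨ ⊗-congˡ (difference (b , a)) (∏-↭ (Permₚ.map⁺ difference X↭Y)) ⟩
    difference (b , a) ⊗ ∏ (map difference Y) ≈⟨ ⊗-congʳ (∏ (map difference Y)) (difference-swap a b) ⟩
    ((- 1#) ⊙ difference (a , b)) ⊗ ∏ (map difference Y) ≈⟨ ⊙-⊗ (- 1#) (difference (a , b)) (∏ (map difference Y)) ⟩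
    (- 1#) ⊙ (difference (a , b) ⊗ ∏ (map difference Y)) ∎
    where
    open ≋-Reasoning
    X = map (b ,_) v ++ map (a ,_) v ++ pairs′ v
    Y = map (a ,_) v ++ map (b ,_) v ++ pairs′ v
    X↭Y : X ↭ Y
    X↭Y = Permₚ.shifts (map (b ,_) v) (map (a ,_) v)
  columnFactors-swap (x ∷ u) a b v = begin
    ∏ (columnFactors (x ∷ u ++ b ∷ a ∷ v))            ≡⟨ cong ∏ (columnFactors-∷ x (u ++ b ∷ a ∷ v)) ⟩
    ∏ (map dx (u ++ b ∷ a ∷ v) ++ columnFactors (u ++ b ∷ a ∷ v))
      ≈⟨ ∏-++ (map dx (u ++ b ∷ a ∷ v)) (columnFactors (u ++ b ∷ a ∷ v)) ⟩
    ∏ (map dx (u ++ b ∷ a ∷ v)) ⊗ ∏ (columnFactors (u ++ b ∷ a ∷ v))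
      ≈⟨ ⊗-congʳ (∏ (columnFactors (u ++ b ∷ a ∷ v))) (∏-↭ (Permₚ.map⁺ dx (Permₚ.++⁺ˡ u (↭-swap b a ↭-refl)))) ⟩
    ∏ (map dx W) ⊗ ∏ (columnFactors (u ++ b ∷ a ∷ v))
      ≈⟨ ⊗-congˡ (∏ (map dx W)) (columnFactors-swap u a b v) ⟩
    ∏ (map dx W) ⊗ ((- 1#) ⊙ ∏ (columnFactors W)) ≈⟨ ⊗-⊙ (- 1#) (∏ (map dx W)) (∏ (columnFactors W)) ⟩
    (- 1#) ⊙ (∏ (map dx W) ⊗ ∏ (columnFactors W)) ≈⟨ ⊙-congˡ (- 1#) (∏-++ (map dx W) (columnFactors W)) ⟨
    (- 1#) ⊙ ∏ (map dx W ++ columnFactors W)      ≡⟨ cong (λ ps → (- 1#) ⊙ ∏ ps) (columnFactors-∷ x W) ⟨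
    (- 1#) ⊙ ∏ (columnFactors (x ∷ W))            ∎
    where
    open ≋-Reasoning
    dx = difference ∘ (x ,_)
    W = u ++ a ∷ b ∷ v

  ∏-concatMap-one : ∀ {A : Set} (F G : A → List 𝒫) k x → (∀ y → y ≢ x → F y ≡ G y) → ∏ (F x) ≋ k ⊙ ∏ (G x) →
                    ∀ {xs} → Unique xs → x ∈ xs → ∏ (concatMap F xs) ≋ k ⊙ ∏ (concatMap G xs)
  ∏-concatMap-one F G k x others Fx {x ∷ xs} (x∉xs AllPairs.∷ _) (here refl) = begin
    ∏ (F x ++ concatMap F xs)          ≈⟨ ∏-++ (F x) (concatMap F xs) ⟩
    ∏ (F x) ⊗ ∏ (concatMap F xs)       ≈⟨ ⊗-congʳ (∏ (concatMap F xs)) Fx ⟩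
    (k ⊙ ∏ (G x)) ⊗ ∏ (concatMap F xs) ≡⟨ cong (λ ps → (k ⊙ ∏ (G x)) ⊗ ∏ ps) concatMap-F≡G ⟩
    (k ⊙ ∏ (G x)) ⊗ ∏ (concatMap G xs) ≈⟨ ⊙-⊗ k (∏ (G x)) (∏ (concatMap G xs)) ⟩
    k ⊙ (∏ (G x) ⊗ ∏ (concatMap G xs)) ≈⟨ ⊙-congˡ k (∏-++ (G x) (concatMap G xs)) ⟨
    k ⊙ ∏ (G x ++ concatMap G xs)      ∎
    where
    open ≋-Reasoning
    concatMap-F≡G : concatMap F xs ≡ concatMap G xs
    concatMap-F≡G = cong concat (Listₚ.map-cong-local (All.tabulate λ {y} y∈xs → others y (λ { refl → All.lookup x∉xs y∈xs refl })))
  ∏-concatMap-one F G k x others Fx {y ∷ xs} (y∉xs AllPairs.∷ uxs) (there x∈xs) = begin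
    ∏ (F y ++ concatMap F xs)          ≈⟨ ∏-++ (F y) (concatMap F xs) ⟩
    ∏ (F y) ⊗ ∏ (concatMap F xs)       ≡⟨ cong (λ ps → ∏ ps ⊗ ∏ (concatMap F xs)) (others y (λ { refl → All.lookup y∉xs x∈xs refl })) ⟩
    ∏ (G y) ⊗ ∏ (concatMap F xs)       ≈⟨ ⊗-congˡ (∏ (G y)) (∏-concatMap-one F G k x others Fx uxs x∈xs) ⟩
    ∏ (G y) ⊗ (k ⊙ ∏ (concatMap G xs)) ≈⟨ ⊗-⊙ k (∏ (G y)) (∏ (concatMap G xs)) ⟩
    k ⊙ (∏ (G y) ⊗ ∏ (concatMap G xs)) ≈⟨ ⊙-congˡ k (∏-++ (G y) (concatMap G xs)) ⟨
    k ⊙ ∏ (G y ++ concatMap G xs)      ∎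
    where open ≋-Reasoning

  specht-transpose : ∀ T → Unique (concat T) → Linked _≥_ (shape T) → ∀ {i j a b} →
                     entry T i j ≡ just a → entry T (suc i) j ≡ just b →
                     specht′ (relabel (transpose a b) T) ≋ (- 1#) ⊙ specht′ T
  specht-transpose T@(r ∷ T′) uT shapeT {i} {j} {a} {b} ea eb
    with u , v , split , swapped ← transpose-column T uT ea eb = begin
    specht′ (relabel f T)
      ≡⟨ cong (∏ ∘ concatMap columnFactors) (columns-relabel f T) ⟩
    ∏ (concatMap columnFactors (map (map f) (columns′ T)))
      ≡⟨ cong ∏ (Listₚ.concatMap-map columnFactors (map f) (columns′ T)) ⟩
    ∏ (concatMap (columnFactors ∘ map f) (map (column T) js))
      ≡⟨ cong ∏ (Listₚ.concatMap-map (columnFactors ∘ map f) (column T) js) ⟩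
    ∏ (concatMap (columnFactors ∘ map f ∘ column T) js)
      ≈⟨ ∏-concatMap-one _ _ (- 1#) j (λ j′ j′≢j → cong columnFactors (transpose-column-other T uT ea eb j′ j′≢j)) negate
                         (Unique.upTo⁺ (length r)) (∈-upTo⁺ (entry-<-length r T′ i j shapeT ea)) ⟩
    (- 1#) ⊙ ∏ (concatMap (columnFactors ∘ column T) js)
      ≡⟨ cong (λ ps → (- 1#) ⊙ ∏ ps) (Listₚ.concatMap-map columnFactors (column T) js) ⟨
    (- 1#) ⊙ specht′ T ∎
    where
    open ≋-Reasoning
    f = transpose a b
    js = upTo (length r)
    negate : ∏ (columnFactors (map f (column T j))) ≋ (- 1#) ⊙ ∏ (columnFactors (column T j))
    negate rewrite swapped | split = columnFactors-swap u a b v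

  -- The row group S_μ and the symmetrizer Y_μ

  allVecs′ : (k : ℕ) → List (Vec (Fin m) k)
  allVecs′ = allVecs K m

  allVecs-cartesian : ∀ k → allVecs′ (suc k) ≡ List.cartesianProductWith (λ v a → a Vec.∷ v) (allVecs′ k) (allFin m)
  allVecs-cartesian k = go (allVecs′ k)
    where
    go : ∀ vs → concatMap (λ v → map (Vec._∷ v) (allFin m)) vs ≡ List.cartesianProductWith (λ v a → a Vec.∷ v) vs (allFin m)
    go []       = refl
    go (v ∷ vs) = cong (map (Vec._∷ v) (allFin m) ++_) (go vs)

  allVecs-complete : ∀ {k} (v : Vec (Fin m) k) → v ∈ allVecs′ k
  allVecs-complete Vec.[]             = here refl
  allVecs-complete {suc k} (a Vec.∷ v) rewrite allVecs-cartesian k =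
    ∈-cartesianProductWith⁺ (λ v a → a Vec.∷ v) (allVecs-complete v) (∈-allFin a)

  allVecs-unique : ∀ k → Unique (allVecs′ k)
  allVecs-unique zero    = [] AllPairs.∷ AllPairs.[]
  allVecs-unique (suc k) rewrite allVecs-cartesian k =
    Unique.cartesianProductWith⁺ (λ v a → a Vec.∷ v) (λ { refl → refl , refl }) (allVecs-unique k) (Unique.allFin⁺ m)

  T-allᵇ⁻ : ∀ {A : Set} (p : A → Bool) {xs} → T (allᵇ K m p xs) → ∀ {x} → x ∈ xs → T (p x)
  T-allᵇ⁻ p {y ∷ xs} t (here refl) = proj₁ (Equivalence.to T-∧ t)
  T-allᵇ⁻ p {y ∷ xs} t (there x∈) = T-allᵇ⁻ p (proj₂ (Equivalence.to T-∧ t)) x∈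

  T-allᵇ⁺ : ∀ {A : Set} (p : A → Bool) xs → (∀ x → T (p x)) → T (allᵇ K m p xs)
  T-allᵇ⁺ p []       _ = _
  T-allᵇ⁺ p (x ∷ xs) t = Equivalence.from T-∧ (t x , T-allᵇ⁺ p xs t)

  isPerm⁻ : ∀ σ → T (isPermᵇ K m σ) → Injective σ
  isPerm⁻ σ t {i} {j} σi≡σj with lookup σ i Finₚ.≟ lookup σ j | i Finₚ.≟ j | T-allᵇ⁻ _ (T-allᵇ⁻ _ t (∈-allFin i)) (∈-allFin j)
  ... | yes _    | yes i≡j | _ = i≡j
  ... | no σi≢σj | _       | _ = ⊥-elim (σi≢σj σi≡σj)

  isPerm⁺ : ∀ σ → Injective σ → T (isPermᵇ K m σ)
  isPerm⁺ σ inj = T-allᵇ⁺ _ (allFin m) λ i → T-allᵇ⁺ _ (allFin m) λ j → pair i j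
    where
    pair : ∀ i j → T (if does (lookup σ i Finₚ.≟ lookup σ j) then does (i Finₚ.≟ j) else true)
    pair i j with lookup σ i Finₚ.≟ lookup σ j | i Finₚ.≟ j
    ... | yes _       | yes _   = _
    ... | yes σi≡σj   | no i≢j  = i≢j (inj σi≡σj)
    ... | no _        | _       = _

  module _ (μ : List ℕ) where

    PreservesRows : FinMap m → Set
    PreservesRows σ = ∀ i → nu μ (suc (toℕ (lookup σ i))) ≡ nu μ (suc (toℕ i))

    IsRowPermutation : FinMap m → Set
    IsRowPermutation σ = Injective σ × PreservesRows σ

    S′ : List (FinMap m)
    S′ = Sμ K m μ

    inSμ⁻ : ∀ σ → T (inSμᵇ K m μ σ) → IsRowPermutation σ
    inSμ⁻ σ t with perm , rows ← Equivalence.to T-∧ t =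
      isPerm⁻ σ perm , λ i → ℕₚ.≡ᵇ⇒≡ _ _ (T-allᵇ⁻ _ rows (∈-allFin i))

    inSμ⁺ : ∀ σ → IsRowPermutation σ → T (inSμᵇ K m μ σ)
    inSμ⁺ σ (inj , rows) = Equivalence.from T-∧ (isPerm⁺ σ inj , T-allᵇ⁺ _ (allFin m) (λ i → ℕₚ.≡⇒≡ᵇ _ _ (rows i)))

    S-sound : ∀ {σ} → σ ∈ S′ → IsRowPermutation σ
    S-sound {σ} σ∈ = inSμ⁻ σ (proj₂ (∈-filter⁻ (T? ∘ inSμᵇ K m μ) {xs = allVecs′ m} σ∈))

    S-complete : ∀ σ → IsRowPermutation σ → σ ∈ S′
    S-complete σ rowPerm = ∈-filter⁺ (T? ∘ inSμᵇ K m μ) (allVecs-complete σ) (inSμ⁺ σ rowPerm)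

    S-unique : Unique S′
    S-unique = Unique.filter⁺ (T? ∘ inSμᵇ K m μ) (allVecs-unique m)

    IsRowPermutation-∘ : ∀ σ τ → IsRowPermutation σ → IsRowPermutation τ → IsRowPermutation (σ ∘ᶠ τ)
    IsRowPermutation-∘ σ τ (injσ , rowsσ) (injτ , rowsτ) =
      (λ {i} {j} eq → injτ (injσ (trans (sym (lookup-∘ᶠ σ τ i)) (trans eq (lookup-∘ᶠ σ τ j))))) ,
      (λ i → trans (cong (nu μ ∘ suc ∘ toℕ) (lookup-∘ᶠ σ τ i)) (trans (rowsσ (lookup τ i)) (rowsτ i)))

    S-reindex : ∀ τ → IsRowPermutation τ → (∀ i → lookup τ (lookup τ i) ≡ i) → map (_∘ᶠ τ) S′ ↭ S′
    S-reindex τ τ∈ τ²≡id = ∼bag⇒↭ (unique∧set⇒bag (Unique.map⁺ ·τ-injective S-unique) S-unique (mk⇔ to from))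
      where
      ·τ-involutive : ∀ σ → (σ ∘ᶠ τ) ∘ᶠ τ ≡ σ
      ·τ-involutive σ = ≡-lookup λ i → trans (lookup-∘ᶠ (σ ∘ᶠ τ) τ i) (trans (lookup-∘ᶠ σ τ (lookup τ i)) (cong (lookup σ) (τ²≡id i)))
      ·τ-injective : ∀ {σ σ′} → σ ∘ᶠ τ ≡ σ′ ∘ᶠ τ → σ ≡ σ′
      ·τ-injective {σ} {σ′} eq = trans (sym (·τ-involutive σ)) (trans (cong (_∘ᶠ τ) eq) (·τ-involutive σ′))
      to : ∀ {σ} → σ ∈ map (_∘ᶠ τ) S′ → σ ∈ S′
      to σ∈ with ρ , ρ∈ , refl ← ∈-map⁻ (_∘ᶠ τ) σ∈ = S-complete (ρ ∘ᶠ τ) (IsRowPermutation-∘ ρ τ (S-sound ρ∈) τ∈)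
      from : ∀ {σ} → σ ∈ S′ → σ ∈ map (_∘ᶠ τ) S′
      from {σ} σ∈ = subst (_∈ map (_∘ᶠ τ) S′) (·τ-involutive σ)
                          (∈-map⁺ (_∘ᶠ τ) (S-complete (σ ∘ᶠ τ) (IsRowPermutation-∘ σ τ (S-sound σ∈) τ∈)))

    Y′ : 𝒫 → 𝒫
    Y′ = Yμ K m μ

    ∣S∣⁻¹ : Carrier
    ∣S∣⁻¹ = recipNat K m (length S′)

    coeff-Y : ∀ p e → coeff′ (Y′ p) e ≈ ∣S∣⁻¹ * sumOf S′ (λ σ → coeff′ (act′ σ p) e)
    coeff-Y p e = ≈-trans (coeff-⊙ ∣S∣⁻¹ (sumP K m (map (λ σ → act′ σ p) S′)) e)
      (*-congˡ (≈-trans (coeff-sumP (map (λ σ → act′ σ p) S′) e) (sumOf-map (λ σ → act′ σ p) S′ (λ q → coeff′ q e))))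

    Y-invariant : ∀ τ → IsRowPermutation τ → (∀ i → lookup τ (lookup τ i) ≡ i) → ∀ p → Y′ (act′ τ p) ≋ Y′ p
    Y-invariant τ τ∈ τ²≡id p = coeffwise λ e → begin
      coeff′ (Y′ (act′ τ p)) e                              ≈⟨ coeff-Y (act′ τ p) e ⟩
      ∣S∣⁻¹ * sumOf S′ (λ σ → coeff′ (act′ σ (act′ τ p)) e) ≈⟨ *-congˡ (sumOf-cong S′ (λ σ → ≈-reflexive (cong (λ q → coeff′ q e) (act-act σ τ p)))) ⟩
      ∣S∣⁻¹ * sumOf S′ (λ σ → coeff′ (act′ (σ ∘ᶠ τ) p) e)   ≈⟨ *-congˡ (sumOf-map (_∘ᶠ τ) S′ (λ σ → coeff′ (act′ σ p) e)) ⟨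
      ∣S∣⁻¹ * sumOf (map (_∘ᶠ τ) S′) (λ σ → coeff′ (act′ σ p) e)
        ≈⟨ *-congˡ (sumOf-↭ (λ σ → coeff′ (act′ σ p) e) (S-reindex τ τ∈ τ²≡id)) ⟩
      ∣S∣⁻¹ * sumOf S′ (λ σ → coeff′ (act′ σ p) e) ≈⟨ coeff-Y p e ⟨
      coeff′ (Y′ p) e                              ∎
      where open ≈-Reasoning

    Y-cong : ∀ {p q} → p ≋ q → Y′ p ≋ Y′ q
    Y-cong {p} {q} p≋q = coeffwise λ e → ≈-trans (coeff-Y p e)
      (≈-trans (*-congˡ (sumOf-cong-∈ S′ (λ {σ} σ∈ → coeff-≈ (act-cong σ (proj₁ (S-sound σ∈)) p≋q) e))) (≈-sym (coeff-Y q e)))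

    Y-⊙ : ∀ k p → Y′ (k ⊙ p) ≋ k ⊙ Y′ p
    Y-⊙ k p = coeffwise λ e → begin
      coeff′ (Y′ (k ⊙ p)) e                           ≈⟨ coeff-Y (k ⊙ p) e ⟩
      ∣S∣⁻¹ * sumOf S′ (λ σ → coeff′ (act′ σ (k ⊙ p)) e)
        ≈⟨ *-congˡ (sumOf-cong S′ (λ σ → ≈-trans (≈-reflexive (cong (λ q → coeff′ q e) (act-⊙ σ k p))) (coeff-⊙ k (act′ σ p) e))) ⟩
      ∣S∣⁻¹ * sumOf S′ (λ σ → k * coeff′ (act′ σ p) e) ≈⟨ *-congˡ (sumOf-* S′ k _) ⟩
      ∣S∣⁻¹ * (k * sumOf S′ (λ σ → coeff′ (act′ σ p) e)) ≈⟨ x∙yz≈y∙xz ∣S∣⁻¹ k _ ⟩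
      k * (∣S∣⁻¹ * sumOf S′ (λ σ → coeff′ (act′ σ p) e)) ≈⟨ *-congˡ (coeff-Y p e) ⟨
      k * coeff′ (Y′ p) e ≈⟨ coeff-⊙ k (Y′ p) e ⟨
      coeff′ (k ⊙ Y′ p) e ∎
      where open ≈-Reasoning

  module FinT = Transposition (Finₚ._≟_ {m})

  transposition : Fin m → Fin m → FinMap m
  transposition a b = tabulate (FinT.transpose a b)

  lookup-transposition : ∀ a b i → lookup (transposition a b) i ≡ FinT.transpose a b i
  lookup-transposition a b = Vecₚ.lookup∘tabulate _

  transposition-involutive : ∀ a b i → lookup (transposition a b) (lookup (transposition a b) i) ≡ i
  transposition-involutive a b i rewrite lookup-transposition a b i | lookup-transposition a b (FinT.transpose a b i) =
    FinT.transpose-involutive a b i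

  transposition-rowPermutation : ∀ μ a b → nu μ (suc (toℕ a)) ≡ nu μ (suc (toℕ b)) → IsRowPermutation μ (transposition a b)
  transposition-rowPermutation μ a b νa≡νb =
    (λ {i} {j} eq → FinT.transpose-injective a b (trans (sym (lookup-transposition a b i)) (trans eq (lookup-transposition a b j)))) ,
    (λ i → trans (cong (nu μ ∘ suc ∘ toℕ) (lookup-transposition a b i)) (FinT.transpose-respects (nu μ ∘ suc ∘ toℕ) a b νa≡νb i))

  applyIndex-transposition : ∀ a b x → applyIndex (transposition a b) x ≡ transpose (suc (toℕ a)) (suc (toℕ b)) x
  applyIndex-transposition a b zero = sym (transpose-fixed (suc (toℕ a)) (suc (toℕ b)) (λ ()) (λ ()))
  applyIndex-transposition a b (suc x) with x ℕ.<? m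
  ... | yes x<m = begin
    suc (toℕ (lookup (transposition a b) k))            ≡⟨ cong (suc ∘ toℕ) (lookup-transposition a b k) ⟩
    suc (toℕ (FinT.transpose a b k))                    ≡⟨ transpose-map Finₚ._≟_ ℕₚ._≟_ (suc ∘ toℕ) (Finₚ.toℕ-injective ∘ ℕₚ.suc-injective) a b k ⟩
    transpose (suc (toℕ a)) (suc (toℕ b)) (suc (toℕ k)) ≡⟨ cong (transpose (suc (toℕ a)) (suc (toℕ b)) ∘ suc) (Finₚ.toℕ-fromℕ< x<m) ⟩
    transpose (suc (toℕ a)) (suc (toℕ b)) (suc x)       ∎
    where
    open ≡-Reasoning
    k = Fin.fromℕ< x<m
  ... | no x≮m = sym (transpose-fixed (suc (toℕ a)) (suc (toℕ b)) (outside a) (outside b))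
    where
    outside : ∀ (i : Fin m) → suc x ≢ suc (toℕ i)
    outside i eq = x≮m (subst (ℕ._< m) (sym (ℕₚ.suc-injective eq)) (Finₚ.toℕ<n i))

  Y-specht-transpose : ∀ μ T {a b} → InRange m a → InRange m b → nu μ a ≡ nu μ b →
                       Y′ μ (specht′ (relabel (transpose a b) T)) ≋ Y′ μ (specht′ T)
  Y-specht-transpose μ T (a , refl) (b , refl) νa≡νb = begin
    Y′ μ (specht′ (relabel (transpose (suc (toℕ a)) (suc (toℕ b))) T)) ≡⟨ cong (Y′ μ ∘ specht′) relabel-τ ⟨
    Y′ μ (specht′ (relabel (applyIndex τ) T)) ≡⟨ cong (Y′ μ) (act-specht τ T) ⟨
    Y′ μ (act′ τ (specht′ T))                 ≈⟨ Y-invariant μ τ τ∈S (transposition-involutive a b) (specht′ T) ⟩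
    Y′ μ (specht′ T)                          ∎
    where
    open ≋-Reasoning
    τ = transposition a b
    τ∈S = transposition-rowPermutation μ a b νa≡νb
    relabel-τ : relabel (applyIndex τ) T ≡ relabel (transpose (suc (toℕ a)) (suc (toℕ b))) T
    relabel-τ = Listₚ.map-cong (Listₚ.map-cong (applyIndex-transposition a b)) T

  -- 2 is invertible in K
  x≈-x⇒x≈0 : ∀ {x} → x ≈ (- 1#) * x → x ≈ 0#
  x≈-x⇒x≈0 {x} x≈-x = begin
    x            ≈⟨ *-identityˡ x ⟨
    1# * x       ≈⟨ *-congʳ (≈-trans (≈-sym (inv-law 2# (charZero 1))) (*-comm 2# ½)) ⟩
    (½ * 2#) * x ≈⟨ *-assoc ½ 2# x ⟩
    ½ * (2# * x) ≈⟨ *-congˡ 2x≈0 ⟩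
    ½ * 0#       ≈⟨ zeroʳ ½ ⟩
    0#           ∎
    where
    open ≈-Reasoning
    2# = natK commRing 2
    ½ = inv 2# (charZero 1)
    2x≈0 : 2# * x ≈ 0#
    2x≈0 = begin
      (1# + (1# + 0#)) * x ≈⟨ *-congʳ (+-congˡ (+-identityʳ 1#)) ⟩
      (1# + 1#) * x        ≈⟨ distribʳ x 1# 1# ⟩
      1# * x + 1# * x      ≈⟨ +-cong (*-identityˡ x) (*-identityˡ x) ⟩
      x + x                ≈⟨ +-congˡ x≈-x ⟩
      x + (- 1#) * x       ≈⟨ +-congˡ (-1*x≈-x x) ⟩
      x - x                ≈⟨ -‿inverseʳ x ⟩
      0#                   ∎

  Y-specht-vanishes : ∀ μ T → Unique (concat T) → Linked _≥_ (shape T) → All (InRange m) (concat T) →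
                      ∀ {i j a b} → entry T i j ≡ just a → entry T (suc i) j ≡ just b → nu μ a ≡ nu μ b →
                      Y′ μ (specht′ T) ≋ 0P K m
  Y-specht-vanishes μ T uT shapeT inRange {i} {j} {a} {b} ea eb νa≡νb = coeffwise λ e → x≈-x⇒x≈0 (begin
    coeff′ (Y′ μ Δ) e
      ≈⟨ coeff-≈ (Y-specht-transpose μ T (All.lookup inRange (entry-∈ T i j ea)) (All.lookup inRange (entry-∈ T (suc i) j eb)) νa≡νb) e ⟨
    coeff′ (Y′ μ (specht′ (relabel (transpose a b) T))) e ≈⟨ coeff-≈ (Y-cong μ (specht-transpose T uT shapeT ea eb)) e ⟩
    coeff′ (Y′ μ ((- 1#) ⊙ Δ)) e ≈⟨ coeff-≈ (Y-⊙ μ (- 1#) Δ) e ⟩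
    coeff′ ((- 1#) ⊙ Y′ μ Δ) e   ≈⟨ coeff-⊙ (- 1#) (Y′ μ Δ) e ⟩
    (- 1#) * coeff′ (Y′ μ Δ) e   ∎)
    where
    open ≈-Reasoning
    Δ = specht′ T

  Y-specht-rowEquivalent : ∀ μ Q → Unique (concat Q) → All (InRange m) (concat Q) →
                           ∀ T → shape T ≡ shape Q → Unique (concat T) → All (InRange m) (concat T) →
                           map (nu μ) (concat T) ≡ map (nu μ) (concat Q) →
                           Y′ μ (specht′ T) ≋ Y′ μ (specht′ Q)
  Y-specht-rowEquivalent μ Q uQ inRangeQ = SortByTranspositions.sort (nu μ) (InRange m) (λ T → Y′ μ (specht′ T) ≋ Y′ μ (specht′ Q))
    (λ T Ra Rb νa≡νb → ≋-trans (≋-sym (Y-specht-transpose μ T Ra Rb νa≡νb))) Q ≋-refl uQ inRangeQ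

  -- Linear independence

  module _ {A : Set} (f : A → 𝒫) where

    combination : List Carrier → List A → 𝒫
    combination cs xs = sumP K m (List.zipWith _⊙_ cs (map f xs))

    coeff-combination-∷ : ∀ k cs x xs e → coeff′ (combination (k ∷ cs) (x ∷ xs)) e ≈ k * coeff′ (f x) e + coeff′ (combination cs xs) e
    coeff-combination-∷ k cs x xs e = ≈-trans (coeff-⊕ (k ⊙ f x) (combination cs xs) e) (+-congʳ (coeff-⊙ k (f x) e))

    coeff-combination-zeros : ∀ xs e → coeff′ (combination (replicate (length xs) 0#) xs) e ≈ 0#
    coeff-combination-zeros []       e = ≈-refl
    coeff-combination-zeros (x ∷ xs) e = ≈-trans (coeff-combination-∷ 0# (replicate (length xs) 0#) x xs e)
      (≈-trans (+-cong (zeroˡ _) (coeff-combination-zeros xs e)) (+-identityʳ 0#))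

    single : ∀ {x : A} {xs} → Carrier → x ∈ xs → List Carrier
    single {xs = _ ∷ xs} k (here _)  = k ∷ replicate (length xs) 0#
    single               k (there p) = 0# ∷ single k p

    length-single : ∀ {x : A} {xs} k (x∈ : x ∈ xs) → length (single k x∈) ≡ length (map f xs)
    length-single {xs = _ ∷ xs} k (here _)  = cong suc (trans (Listₚ.length-replicate (length xs)) (sym (Listₚ.length-map f xs)))
    length-single               k (there p) = cong suc (length-single k p)

    coeff-single : ∀ {x : A} {xs} k (x∈ : x ∈ xs) e → coeff′ (combination (single k x∈) xs) e ≈ k * coeff′ (f x) e
    coeff-single {xs = x ∷ xs} k (here refl) e =
      ≈-trans (coeff-combination-∷ k (replicate (length xs) 0#) x xs e) (≈-trans (+-congˡ (coeff-combination-zeros xs e)) (+-identityʳ _))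
    coeff-single {xs = y ∷ xs} k (there p) e =
      ≈-trans (coeff-combination-∷ 0# (single k p) y xs e) (≈-trans (+-congʳ (zeroˡ _)) (≈-trans (+-identityˡ _) (coeff-single k p e)))

    single-zero : ∀ {x : A} {xs} k (x∈ : x ∈ xs) → All (_≈ 0#) (single k x∈) → k ≈ 0#
    single-zero k (here _)  (k≈0 ∷ _) = k≈0
    single-zero k (there p) (_ ∷ zs)  = single-zero k p zs

    LinIndep-nonzero : ∀ {x : A} {xs} → LinIndep K m (map f xs) → x ∈ xs → ¬ (f x ≋ 0P K m)
    LinIndep-nonzero indep x∈ (coeffwise fx≈0) = 0≉1 (≈-sym (single-zero 1# x∈
      (indep (single 1# x∈) (length-single 1# x∈) λ e → ≈-trans (coeff-single 1# x∈ e) (≈-trans (*-congˡ (fx≈0 e)) (zeroʳ 1#)))))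

    signedPair : ∀ {x y : A} {xs} → x ∈ xs → y ∈ xs → x ≢ y → List Carrier
    signedPair (here refl) (here refl) x≢y = ⊥-elim (x≢y refl)
    signedPair (here refl) (there y∈)  _   = 1# ∷ single (- 1#) y∈
    signedPair (there x∈)  (here refl) _   = (- 1#) ∷ single 1# x∈
    signedPair (there x∈)  (there y∈)  x≢y = 0# ∷ signedPair x∈ y∈ x≢y

    length-signedPair : ∀ {x y : A} {xs} (x∈ : x ∈ xs) (y∈ : y ∈ xs) x≢y → length (signedPair x∈ y∈ x≢y) ≡ length (map f xs)
    length-signedPair (here refl) (here refl) x≢y = ⊥-elim (x≢y refl)
    length-signedPair (here refl) (there y∈)  _   = cong suc (length-single (- 1#) y∈)
    length-signedPair (there x∈)  (here refl) _   = cong suc (length-single 1# x∈)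
    length-signedPair (there x∈)  (there y∈)  x≢y = cong suc (length-signedPair x∈ y∈ x≢y)

    coeff-signedPair : ∀ {x y : A} {xs} (x∈ : x ∈ xs) (y∈ : y ∈ xs) x≢y e →
                       coeff′ (combination (signedPair x∈ y∈ x≢y) xs) e ≈ coeff′ (f x) e + (- 1#) * coeff′ (f y) e
    coeff-signedPair (here refl) (here refl) x≢y e = ⊥-elim (x≢y refl)
    coeff-signedPair {xs = x ∷ xs} (here refl) (there y∈) _ e =
      ≈-trans (coeff-combination-∷ 1# (single (- 1#) y∈) x xs e) (+-cong (*-identityˡ _) (coeff-single (- 1#) y∈ e))
    coeff-signedPair {xs = y ∷ xs} (there x∈) (here refl) _ e =
      ≈-trans (coeff-combination-∷ (- 1#) (single 1# x∈) y xs e) (≈-trans (+-congˡ (≈-trans (coeff-single 1# x∈ e) (*-identityˡ _))) (+-comm _ _))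
    coeff-signedPair {xs = z ∷ xs} (there x∈) (there y∈) x≢y e =
      ≈-trans (coeff-combination-∷ 0# (signedPair x∈ y∈ x≢y) z xs e)
              (≈-trans (+-congʳ (zeroˡ _)) (≈-trans (+-identityˡ _) (coeff-signedPair x∈ y∈ x≢y e)))

    signedPair-zero : ∀ {x y : A} {xs} (x∈ : x ∈ xs) (y∈ : y ∈ xs) x≢y → All (_≈ 0#) (signedPair x∈ y∈ x≢y) → 1# ≈ 0#
    signedPair-zero (here refl) (here refl) x≢y _        = ⊥-elim (x≢y refl)
    signedPair-zero (here refl) (there y∈)  _   (1≈0 ∷ _) = 1≈0
    signedPair-zero (there x∈)  (here refl) _   (_ ∷ zs)  = single-zero 1# x∈ zs
    signedPair-zero (there x∈)  (there y∈)  x≢y (_ ∷ zs)  = signedPair-zero x∈ y∈ x≢y zs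

    LinIndep-injective : ∀ {x y : A} {xs} → LinIndep K m (map f xs) → x ∈ xs → y ∈ xs → x ≢ y → ¬ (f x ≋ f y)
    LinIndep-injective indep x∈ y∈ x≢y (coeffwise fx≈fy) = 0≉1 (≈-sym (signedPair-zero x∈ y∈ x≢y
      (indep (signedPair x∈ y∈ x≢y) (length-signedPair x∈ y∈ x≢y) λ e →
        ≈-trans (coeff-signedPair x∈ y∈ x≢y e)
                (≈-trans (+-congˡ (*-congˡ (≈-sym (fx≈fy e)))) (≈-trans (+-congˡ (-1*x≈-x _)) (-‿inverseʳ _))))))

mainTheorem14 : ∀ {c ℓ} (K : CharZeroField c ℓ) (m : ℕ) (la mu : List ℕ) →
    IsPartition m la → IsPartition m mu →
    (S : List Tableau) → IsMaxIndepStd K m la mu S →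
    ∀ Q Q' → Q ∈ S → Q' ∈ S →
    IsSemiStandard la mu (nuT mu Q) × (¬ Q ≡ Q' → ¬ nuT mu Q ≡ nuT mu Q')
mainTheorem14 K .(sum mu) la mu (la-decreasing , _) (_ , _ , refl) S (standard , _ , independent , _) Q Q' Q∈S Q'∈S =
  nuT-semistandard mu stdQ columnRowsDistinct , νQ-injective
  where
  open Symmetrizer K (sum mu)
  stdQ = All.lookup standard Q∈S
  stdQ' = All.lookup standard Q'∈S
  columnRowsDistinct : ∀ {i j a b} → entry Q i j ≡ just a → entry Q (suc i) j ≡ just b → nu mu a ≢ nu mu b
  columnRowsDistinct ea eb νa≡νb = LinIndep-nonzero (Y′ mu ∘ specht′) independent Q∈S
    (Y-specht-vanishes mu Q (standard-unique stdQ) (subst (Linked _≥_) (sym (proj₁ stdQ)) la-decreasing) (standard-inRange stdQ) ea eb νa≡νb)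
  νQ-injective : ¬ Q ≡ Q' → ¬ nuT mu Q ≡ nuT mu Q'
  νQ-injective Q≢Q' νQ≡νQ' = LinIndep-injective (Y′ mu ∘ specht′) independent Q∈S Q'∈S Q≢Q'
    (Y-specht-rowEquivalent mu Q' (standard-unique stdQ') (standard-inRange stdQ') Q (trans (proj₁ stdQ) (sym (proj₁ stdQ')))
      (standard-unique stdQ) (standard-inRange stdQ) (trans (sym (Listₚ.concat-map Q)) (trans (cong concat νQ≡νQ') (Listₚ.concat-map Q'))))
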